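{- Let $m\geq 3$, let $\zeta$ be a polarity of $\mathrm{PG}(m-1,q)$, and let $\pi$ be a subspace of projective dimension $k-1\geq 0$ which is totally isotropic with respect to $\zeta$ (i.e. $\pi\subseteq\pi^\zeta$). Let $\Gamma$ be the graph with vertex set the set of points of $\mathrm{PG}(m-1,q)$ not contained in $\pi^\zeta$, in which two (possibly equal) vertices $x,y$ are adjacent whenever $y\in x^\zeta$. Then $\Gamma$ is an LDDG with parameters $$\left(\frac{q^{m-k}(q^k-1)}{q-1},\ \frac{q^{m-k-1}(q^k-1)}{q-1},\ \frac{q^{m-k-1}(q^{k-1}-1)}{q-1},\ \frac{q^{m-k-2}(q^k-1)}{q-1},\ \frac{q^{m-k}-q^{m-2k}}{q-1},\ q^k\right).$$
   Context: $\mathrm{PG}(m-1,q)$ is the projective space of $\mathbb{F}_q^m$: points are 1-dimensional subspaces, and a projective subspace of dimension $i$ is the set of points in an $(i+1)$-dimensional vector subspace. A polarity $\zeta$ is an inclusion-reversing bijection of the set of subspaces with $\zeta^2=\mathrm{id}$; for a point $x$, $x^\zeta$ is a hyperplane and $x\in y^\zeta$ iff $y\in x^\zeta$. Graphs here are finite, undirected, without multiple edges, but loops are allowed: a vertex may be adjacent to itself. For a vertex $x$, $\Gamma(x)$ is the set of vertices adjacent to $x$ (containing $x$ iff $x$ has a loop), and the degree of $x$ is $|\Gamma(x)|$ (a loop contributes exactly 1). Common neighbours of $x,y$ are the elements of $\Gamma(x)\cap\Gamma(y)$. A $K$-regular graph on $v$ vertices is an LDDG with parameters $(v,K,\lambda_1,\lambda_2,M,n)$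 if its vertex set can be partitioned into $M$ classes of size $n$ such that any two distinct vertices of the same class have exactly $\lambda_1$ common neighbours and any two vertices of different classes have exactly $\lambda_2$ common neighbours. -}

module Defs where

open import Level using (0ℓ)
open import Data.Nat using (ℕ; zero; suc)
open import Data.Bool using (Bool; true; false; _∧_; not; if_then_else_)
open import Data.Fin using (Fin)
import Data.Fin.Properties as FinP
open import Data.Vec using (Vec; []; _∷_; zipWith; map; replicate; foldr)
import Data.Vec.Properties as VecP
open import Data.List as List using (List; []; _∷_; concatMap; filter; length)
open import Data.Bool.ListAction using (any)
open import Data.List.Base using (allFin)
open import Data.Product using (Σ; _×_; _,_; ∃)
open import Relation.Nullary using (¬_; does)
open import Relation.Binary.PropositionalEquality using (_≡_)
open import Algebra.Structures using (IsCommutativeRing)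

-- A finite field of order q, realised on the carrier Fin q with
-- propositional equality (every finite field of order q is isomorphic
-- to such a structure).

record FiniteField (q : ℕ) : Set where
  field
    _+_ _*_ : Fin q → Fin q → Fin q
    -_      : Fin q → Fin q
    0# 1#   : Fin q
    isCommutativeRing : IsCommutativeRing _≡_ _+_ _*_ -_ 0# 1#
    0≢1     : ¬ (0# ≡ 1#)
    inverse : ∀ x → ¬ (x ≡ 0#) → ∃ λ y → x * y ≡ 1#

module Geometry {q : ℕ} (F : FiniteField q) (m : ℕ) where
  open FiniteField F

  V : Set
  V = Vec (Fin q) m

  infix 4 _==_
  _==_ : V → V → Bool
  u == v = does (VecP.≡-dec FinP._≟_ u v)

  zeroV : V
  zeroV = replicate m 0#

  _+V_ : V → V → V
  u +V v = zipWith _+_ u v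

  _·_ : Fin q → V → V
  c · v = map (c *_) v

  allVecs : (n : ℕ) → List (Vec (Fin q) n)
  allVecs zero    = [] ∷ []
  allVecs (suc n) = concatMap (λ a → List.map (a ∷_) (allVecs n)) (allFin q)

  count : (V → Bool) → ℕ
  count P = length (filter (λ v → Data.Bool._≟_ (P v) true) (allVecs m))
    where import Data.Bool

  -- Vector subspaces of F^m, given by (decidable) membership predicates.
  -- (Projective subspaces of PG(m-1,q) correspond to these.)

  Pred : Set
  Pred = V → Bool

  _∈_ : V → Pred → Set
  v ∈ U = U v ≡ true

  _⊆_ : Pred → Pred → Set
  U ⊆ W = ∀ v → v ∈ U → v ∈ W

  record IsSubspace (U : Pred) : Set where
    field
      zero∈ : zeroV ∈ U
      +-closed : ∀ u v → u ∈ U → v ∈ U → (u +V v) ∈ U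
      ·-closed : ∀ c v → v ∈ U → (c · v) ∈ U

  lincomb : {k : ℕ} → Vec (Fin q) k → Vec V k → V
  lincomb cs bs = foldr (λ _ → V) _+V_ zeroV (zipWith _·_ cs bs)

  -- U has (vector) dimension k: it has a basis of k vectors
  HasDim : Pred → ℕ → Set
  HasDim U k = Σ (Vec V k) λ bs →
      (∀ cs → lincomb cs bs ∈ U)
    × (∀ cs → lincomb cs bs ≡ zeroV → cs ≡ replicate k 0#)
    × (∀ v → v ∈ U → ∃ λ cs → v ≡ lincomb cs bs)

  -- A polarity: an inclusion-reversing involution on the set of
  -- subspaces.  ζ is given as a map on predicates; only its behaviour
  -- on subspaces is constrained.
  record IsPolarity (ζ : Pred → Pred) : Set where
    field
      subspace↦subspace : ∀ U → IsSubspace U → IsSubspace (ζ U)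
      reversing : ∀ U W → IsSubspace U → IsSubspace W → U ⊆ W → ζ W ⊆ ζ U
      involutive : ∀ U → IsSubspace U → ∀ v → ζ (ζ U) v ≡ U v

  -- Points of PG(m-1,q): each point (1-dim subspace) is represented by
  -- its unique normalised spanning vector: nonzero, first nonzero
  -- coordinate equal to 1.

  normalised : {n : ℕ} → Vec (Fin q) n → Bool
  normalised [] = false
  normalised (a ∷ v) =
    if does (FinP._≟_ a 0#) then normalised v else does (FinP._≟_ a 1#)

  isPoint : Pred
  isPoint = normalised

  span : V → Pred
  span x w = any (λ c → w == (c · x)) (allFin q)

  perp : (Pred → Pred) → V → Pred
  perp ζ x = ζ (span x)

  isVertex : (Pred → Pred) → Pred → Pred
  isVertex ζ π x = isPoint x ∧ not (ζ π x)

  adj : (Pred → Pred) → V → V → Bool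
  adj ζ x y = perp ζ x y

  IsLDDG : (vert : Pred) (ad : V → V → Bool)
           (v K λ₁ λ₂ M n : ℕ) → Set
  IsLDDG vert ad v K λ₁ λ₂ M n =
      count vert ≡ v
    × (∀ x → x ∈ vert → count (λ y → vert y ∧ ad x y) ≡ K)
    × Σ (V → Fin M) λ cls →
        (∀ i → count (λ y → vert y ∧ does (FinP._≟_ (cls y) i)) ≡ n)
      × (∀ x y → x ∈ vert → y ∈ vert → ¬ (x ≡ y) → cls x ≡ cls y →
           count (λ z → vert z ∧ (ad x z ∧ ad y z)) ≡ λ₁)
      × (∀ x y → x ∈ vert → y ∈ vert → ¬ (cls x ≡ cls y) →
           count (λ z → vert z ∧ (ad x z ∧ ad y z)) ≡ λ₂)

{-# OPTIONS --safe #-}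
module Submission where

-- Write π = ⟨b₁, …, b_k⟩.  The vertices adjacent to every vector of a family A are the points
-- of ζ⟨A⟩ outside ζ⟨A⟩ ∩ ζπ = ζ⟨A, π⟩, and nested subspaces W ⊆ U leave (|U| − |W|)/(q − 1)
-- points in U ∖ W.  As ζ sends a subspace of dimension d to one of dimension m − d, the families
-- A = (), (x), (x, y) give the number of vertices, the valency and λ₂ (there x, y, b₁, …, b_k
-- are independent) and λ₁ (there ⟨x, y, π⟩ = ⟨x, π⟩).  The classes are the sets ⟨x, π⟩ ∖ π;
-- isotropy π ⊆ ζπ makes all q^k points of such a set vertices.

open import Data.Nat using (ℕ; _≤_)
open import Defs

module Counting where

  open import Data.Bool using (Bool; true; false; _∧_; not; _≟_; if_then_else_)
  open import Data.Bool.Properties using (T-≡)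
  open import Data.Bool.ListAction using (any)
  open import Data.Nat using (zero; suc; _+_; _*_; _∸_; _<_; z≤n; s≤s)
  open import Data.Nat.Properties using (<⇒≢; +-suc; m≤n⇒m≤1+n; +-0-commutativeMonoid)
  open import Data.Fin using (Fin)
  import Data.Fin as Fin
  import Data.Fin.Properties as Fin
  open import Data.List using (List; []; _∷_; length; filter; map; lookup; _++_; cartesianProductWith)
  open import Data.List.Properties using (length-filter; filter-some; filter-none; length-map; length-++)
  open import Data.List.Membership.Propositional using (_∈_)
  open import Data.List.Membership.Propositional.Properties
    using (∈-filter⁺; ∈-filter⁻; ∈-map⁺; ∈-map⁻; ∈-lookup)
  open import Data.List.Membership.Propositional.Properties.WithK using (unique∧set⇒bag)
  open import Data.List.Relation.Unary.Any as Any using (Any; here; there; any?)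
  open import Data.List.Relation.Unary.Any.Properties using (lookup-result; lookup-index; any⁺; any⁻)
  open import Data.List.Relation.Unary.All using (All; []; _∷_)
  import Data.List.Relation.Unary.All as All
  open import Data.List.Relation.Unary.All.Properties using (¬Any⇒All¬)
  open import Data.List.Relation.Unary.AllPairs using (AllPairs; []; _∷_)
  open import Data.List.Relation.Unary.Unique.Propositional using (Unique)
  import Data.List.Relation.Unary.Unique.Propositional.Properties as Unique
  open import Data.List.Relation.Binary.BagAndSetEquality using (∼bag⇒↭)
  open import Data.List.Relation.Binary.Permutation.Propositional.Properties using (↭-length)
  open import Data.Product using (∃; _×_; _,_; proj₂)
  open import Function using (_∘_)
  open import Function.Bundles using (_⇔_; mk⇔; Equivalence)
  open import Relation.Binary.PropositionalEquality
    using (_≡_; refl; sym; trans; cong; cong₂; subst; _≗_; module ≡-Reasoning)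
  open import Relation.Nullary using (Dec; yes; no; ¬_; does; contradiction)
  open import Algebra.Properties.CommutativeMonoid.Sum +-0-commutativeMonoid
    using (∑-distrib-+; sum-replicate-zero; sum-cong-≗; sum-remove)
    renaming (sum-syntax to ∑-syntax)

  ∧-intro : ∀ {a b} → a ≡ true → b ≡ true → a ∧ b ≡ true
  ∧-intro refl refl = refl

  not-intro : ∀ {a} → ¬ a ≡ true → not a ≡ true
  not-intro {false} _   = refl
  not-intro {true}  a≢t = contradiction refl a≢t

  not-elim : ∀ {a} → not a ≡ true → ¬ a ≡ true
  not-elim {false} _ ()

  ∧-not-elim : ∀ {a b} → a ∧ not b ≡ true → a ≡ true × ¬ b ≡ true
  ∧-not-elim {true} {false} _ = refl , λ ()

  does-true⇒ : ∀ {P : Set} (p? : Dec P) → does p? ≡ true → P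
  does-true⇒ (yes p) _ = p

  ∑-const : ∀ n c → ∑[ i < n ] c ≡ n * c
  ∑-const zero    c = refl
  ∑-const (suc n) c = cong (c +_) (∑-const n c)

  ∑-hole : ∀ {n} (g : Fin n → ℕ) (j : Fin n) {c} → g j ≡ 0 → (∀ i → ¬ i ≡ j → g i ≡ c) →
    ∑[ i < n ] g i ≡ (n ∸ 1) * c
  ∑-hole {suc n} g j {c} gj≡0 g≡c = begin
    ∑[ i < suc n ] g i                    ≡⟨ sum-remove {i = j} g ⟩
    g j + ∑[ i < n ] g (Fin.punchIn j i)  ≡⟨ cong₂ _+_ gj≡0 (sum-cong-≗ λ i → g≡c _ (Fin.punchInᵢ≢i j i)) ⟩
    ∑[ i < n ] c                          ≡⟨ ∑-const n c ⟩
    n * c                                 ∎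
    where open ≡-Reasoning

  length-cartesianProductWith : ∀ {A B C : Set} (f : A → B → C) xs ys →
    length (cartesianProductWith f xs ys) ≡ length xs * length ys
  length-cartesianProductWith f []       ys = refl
  length-cartesianProductWith f (x ∷ xs) ys = begin
    length (map (f x) ys ++ cartesianProductWith f xs ys)          ≡⟨ length-++ (map (f x) ys) ⟩
    length (map (f x) ys) + length (cartesianProductWith f xs ys)  ≡⟨ cong₂ _+_ (length-map (f x) ys)
                                                                                  (length-cartesianProductWith f xs ys) ⟩
    length ys + length xs * length ys                              ∎
    where open ≡-Reasoning

  module _ {A : Set} where

    countIn : List A → (A → Bool) → ℕ
    countIn xs P = length (filter (λ x → P x ≟ true) xs)

    countIn-cong : ∀ xs {P Q : A → Bool} → P ≗ Q → countIn xs P ≡ countIn xs Q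
    countIn-cong []       P≗Q = refl
    countIn-cong (x ∷ xs) {P} {Q} P≗Q rewrite P≗Q x with Q x
    ... | true  = cong suc (countIn-cong xs P≗Q)
    ... | false = countIn-cong xs P≗Q

    countIn-mono : ∀ xs {P Q : A → Bool} → (∀ x → P x ≡ true → Q x ≡ true) → countIn xs P ≤ countIn xs Q
    countIn-mono []       P⊆Q = z≤n
    countIn-mono (x ∷ xs) {P} {Q} P⊆Q with P x in Px | Q x in Qx
    ... | true  | true  = s≤s (countIn-mono xs P⊆Q)
    ... | true  | false with () ← trans (sym (P⊆Q x Px)) Qx
    ... | false | true  = m≤n⇒m≤1+n (countIn-mono xs P⊆Q)
    ... | false | false = countIn-mono xs P⊆Q

    countIn-split : ∀ xs (P Q : A → Bool) →
      countIn xs P ≡ countIn xs (λ x → P x ∧ Q x) + countIn xs (λ x → P x ∧ not (Q x))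
    countIn-split []       P Q = refl
    countIn-split (x ∷ xs) P Q with P x | Q x
    ... | true  | true  = cong suc (countIn-split xs P Q)
    ... | true  | false = trans (cong suc (countIn-split xs P Q)) (sym (+-suc _ _))
    ... | false | _     = countIn-split xs P Q

    countIn-true : ∀ xs → countIn xs (λ _ → true) ≡ length xs
    countIn-true []       = refl
    countIn-true (x ∷ xs) = cong suc (countIn-true xs)

    countIn-none : ∀ xs {P : A → Bool} → (∀ x → ¬ P x ≡ true) → countIn xs P ≡ 0
    countIn-none xs {P} none =
      cong length (filter-none (λ x → P x ≟ true) {xs = xs} (All.tabulate λ {x} _ → none x))

    countIn-≤-length : ∀ xs (P : A → Bool) → countIn xs P ≤ length xs
    countIn-≤-length xs P = length-filter (λ x → P x ≟ true) xs

    countIn-witness : ∀ xs (P : A → Bool) → 0 < countIn xs P → ∃ λ x → P x ≡ true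
    countIn-witness xs P _ with filter (λ x → P x ≟ true) xs in eq
    ... | y ∷ _ = y , proj₂ (∈-filter⁻ (λ x → P x ≟ true) {xs = xs} (subst (y ∈_) (sym eq) (here refl)))

    private
      indicator : Bool → ℕ
      indicator b = if b then 1 else 0

      countIn-∷ : ∀ x xs (P : A → Bool) → countIn (x ∷ xs) P ≡ indicator (P x) + countIn xs P
      countIn-∷ x xs P with P x
      ... | true  = refl
      ... | false = refl

      ∑-indicator : ∀ {n} b (j : Fin n) → ∑[ i < n ] indicator (b ∧ does (j Fin.≟ i)) ≡ indicator b
      ∑-indicator {suc n} false j           = sum-replicate-zero (suc n)
      ∑-indicator {suc n} true  Fin.zero    = cong suc (sum-replicate-zero n)
      ∑-indicator {suc n} true  (Fin.suc j) = ∑-indicator true j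

    countIn-fibres : ∀ xs {n} (f : A → Fin n) (P : A → Bool) →
      countIn xs P ≡ ∑[ i < n ] countIn xs (λ x → P x ∧ does (f x Fin.≟ i))
    countIn-fibres []       {n} f P = sym (sum-replicate-zero n)
    countIn-fibres (x ∷ xs) {n} f P = begin
      countIn (x ∷ xs) P                                          ≡⟨ countIn-∷ x xs P ⟩
      indicator (P x) + countIn xs P                              ≡⟨ cong₂ _+_ (sym (∑-indicator (P x) (f x)))
                                                                                (countIn-fibres xs f P) ⟩
      ∑[ i < n ] indicator (Q i x) + ∑[ i < n ] countIn xs (Q i)  ≡⟨ ∑-distrib-+ (λ i → indicator (Q i x)) _ ⟨
      ∑[ i < n ] (indicator (Q i x) + countIn xs (Q i))           ≡⟨ sum-cong-≗ (λ i → sym (countIn-∷ x xs (Q i))) ⟩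
      ∑[ i < n ] countIn (x ∷ xs) (Q i)                           ∎
      where
      open ≡-Reasoning
      Q : Fin n → A → Bool
      Q i y = P y ∧ does (f y Fin.≟ i)

  module Enumeration {A : Set} (xs : List A) (complete : ∀ x → x ∈ xs) where

    any-⇔ : ∀ {P : A → Bool} → any P xs ≡ true ⇔ ∃ λ x → P x ≡ true
    any-⇔ {P} = mk⇔
      (λ anyP → let p = any⁻ P xs (Equivalence.from T-≡ anyP) in
                Any.lookup p , Equivalence.to T-≡ (lookup-result p))
      (λ (x , Px) → Equivalence.to T-≡ (any⁺ P (Any.map (λ { refl → Equivalence.from T-≡ Px }) (complete x))))

    satisfiable? : (P : A → Bool) → Dec (∃ λ x → P x ≡ true)
    satisfiable? P with any P xs in anyP
    ... | true  = yes (Equivalence.to any-⇔ anyP)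
    ... | false = no λ w → contradiction (trans (sym anyP) (Equivalence.from any-⇔ w)) λ ()

    countIn-pos : ∀ {P : A → Bool} {x} → P x ≡ true → 0 < countIn xs P
    countIn-pos {P} Px = filter-some (λ x → P x ≟ true) (Any.map (λ { refl → Px }) (complete _))

    countIn-<-length : ∀ (P : A → Bool) → countIn xs P < length xs → ∃ λ x → ¬ P x ≡ true
    countIn-<-length P lt with satisfiable? (not ∘ P)
    ... | yes (x , ¬Px) = x , not-elim ¬Px
    ... | no  none      = contradiction (trans (countIn-cong xs all-true) (countIn-true xs)) (<⇒≢ lt)
      where
      all-true : P ≗ λ _ → true
      all-true x with P x in Px
      ... | true  = refl
      ... | false = contradiction (x , cong not Px) none

    module _ (unique : Unique xs) where

      countIn-≡-length : ∀ {P : A → Bool} {ys} → Unique ys → (∀ {x} → x ∈ ys ⇔ P x ≡ true) →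
        countIn xs P ≡ length ys
      countIn-≡-length {P} ys-unique ys⇔P = ↭-length (∼bag⇒↭ (unique∧set⇒bag
        (Unique.filter⁺ (λ x → P x ≟ true) unique) ys-unique
        (mk⇔ (λ x∈ → Equivalence.from ys⇔P (proj₂ (∈-filter⁻ (λ x → P x ≟ true) {xs = xs} x∈)))
             (λ x∈ → ∈-filter⁺ (λ x → P x ≟ true) (complete _) (Equivalence.to ys⇔P x∈)))))

      countIn-∘-inverse : (P : A → Bool) (f g : A → A) → (∀ x → f (g x) ≡ x) → (∀ x → g (f x) ≡ x) →
        countIn xs (P ∘ f) ≡ countIn xs P
      countIn-∘-inverse P f g fg gf = begin
        length (filter (λ x → P (f x) ≟ true) xs)  ≡⟨ length-map f (filter (λ x → P (f x) ≟ true) xs) ⟨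
        length image                               ≡⟨ countIn-≡-length image-unique (mk⇔ image⊆P P⊆image) ⟨
        countIn xs P                               ∎
        where
        open ≡-Reasoning
        image : List A
        image = map f (filter (λ x → P (f x) ≟ true) xs)
        image-unique : Unique image
        image-unique = Unique.map⁺ (λ {x} {y} e → trans (sym (gf x)) (trans (cong g e) (gf y)))
                         (Unique.filter⁺ (λ x → P (f x) ≟ true) unique)
        image⊆P : ∀ {z} → z ∈ image → P z ≡ true
        image⊆P z∈ with ∈-map⁻ f z∈
        ... | y , y∈ , refl = proj₂ (∈-filter⁻ (λ x → P (f x) ≟ true) {xs = xs} y∈)
        P⊆image : ∀ {z} → P z ≡ true → z ∈ image
        P⊆image {z} Pz = subst (_∈ image) (fg z)
          (∈-map⁺ f (∈-filter⁺ (λ x → P (f x) ≟ true) (complete (g z))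
                                (subst (λ y → P y ≡ true) (sym (fg z)) Pz)))

  module Classification {A : Set} (xs : List A) (complete : ∀ x → x ∈ xs)
    (P : A → Bool) (R : A → A → Bool)
    (R-refl  : ∀ {x} → P x ≡ true → R x x ≡ true)
    (R-sym   : ∀ {x y} → P x ≡ true → P y ≡ true → R x y ≡ true → R y x ≡ true)
    (R-trans : ∀ {x y z} → P x ≡ true → P y ≡ true → P z ≡ true →
               R x y ≡ true → R y z ≡ true → R x z ≡ true)
    {a₀ : A} (Pa₀ : P a₀ ≡ true)
    where

    private
      related? : ∀ x rs → Dec (Any (λ r → R x r ≡ true) rs)
      related? x = any? (λ r → R x r ≟ true)

      Apart : A → A → Set
      Apart r s = ¬ R r s ≡ true

    representatives : List A → List A
    representatives []       = []
    representatives (x ∷ ys) with P x | related? x (representatives ys)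
    ... | true | no _ = x ∷ representatives ys
    ... | _    | _    = representatives ys

    representatives-P : ∀ ys → All (λ r → P r ≡ true) (representatives ys)
    representatives-P []       = []
    representatives-P (x ∷ ys) with P x in Px | related? x (representatives ys)
    ... | true  | no _  = Px ∷ representatives-P ys
    ... | true  | yes _ = representatives-P ys
    ... | false | _     = representatives-P ys

    representatives-apart : ∀ ys → AllPairs Apart (representatives ys)
    representatives-apart []       = []
    representatives-apart (x ∷ ys) with P x | related? x (representatives ys)
    ... | true  | no ¬r = ¬Any⇒All¬ _ ¬r ∷ representatives-apart ys
    ... | true  | yes _ = representatives-apart ys
    ... | false | _     = representatives-apart ys

    representatives-cover : ∀ ys {x} → x ∈ ys → P x ≡ true → Any (λ r → R x r ≡ true) (representatives ys)
    representatives-cover (y ∷ ys) {x} x∈ Px with P y in Py | related? y (representatives ys) | x∈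
    ... | true  | no _  | here refl  = here (R-refl Px)
    ... | true  | no _  | there x∈ys = there (representatives-cover ys x∈ys Px)
    ... | true  | yes r | here refl  = r
    ... | true  | yes _ | there x∈ys = representatives-cover ys x∈ys Px
    ... | false | _     | here refl  = contradiction (trans (sym Px) Py) λ ()
    ... | false | _     | there x∈ys = representatives-cover ys x∈ys Px

    size : ℕ
    size = length (representatives xs)

    rep : Fin size → A
    rep = lookup (representatives xs)

    rep-P : ∀ i → P (rep i) ≡ true
    rep-P i = All.lookup (representatives-P xs) (∈-lookup i)

    private
      lookup-apart : ∀ {rs} → All (λ r → P r ≡ true) rs → AllPairs Apart rs →
        ∀ i j → R (lookup rs i) (lookup rs j) ≡ true → i ≡ j
      lookup-apart (_ ∷ _)   _       Fin.zero    Fin.zero    _ = refl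
      lookup-apart (_ ∷ _)   (h ∷ _) Fin.zero    (Fin.suc j) r = contradiction r (All.lookup h (∈-lookup j))
      lookup-apart (P₀ ∷ Ps) (h ∷ _) (Fin.suc i) Fin.zero    r =
        contradiction (R-sym (All.lookup Ps (∈-lookup i)) P₀ r) (All.lookup h (∈-lookup i))
      lookup-apart (_ ∷ Ps)  (_ ∷ hs) (Fin.suc i) (Fin.suc j) r = cong Fin.suc (lookup-apart Ps hs i j r)

    -- Elements outside P are sent to the class of a₀.
    class : A → Fin size
    class x with related? x (representatives xs)
    ... | yes r = Any.index r
    ... | no  _ = Any.index (representatives-cover xs (complete a₀) Pa₀)

    class-spec : ∀ {x} → P x ≡ true → ∀ i → class x ≡ i ⇔ R (rep i) x ≡ true
    class-spec {x} Px i with related? x (representatives xs)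
    ... | no ¬r = contradiction (representatives-cover xs (complete x) Px) ¬r
    ... | yes r = mk⇔ to from
      where
      x~rep : R x (rep (Any.index r)) ≡ true
      x~rep = lookup-index r
      to : Any.index r ≡ i → R (rep i) x ≡ true
      to refl = R-sym Px (rep-P (Any.index r)) x~rep
      from : R (rep i) x ≡ true → Any.index r ≡ i
      from rep~x = sym (lookup-apart (representatives-P xs) (representatives-apart xs) i (Any.index r)
        (R-trans (rep-P i) Px (rep-P (Any.index r)) rep~x x~rep))

module Arithmetic where

  open import Data.Nat
  open import Data.Nat.Properties
  open import Data.Nat.Solver using (module +-*-Solver)
  open import Data.Sum using (inj₁; inj₂)
  open import Relation.Binary.PropositionalEquality
  open import Relation.Nullary using (contradiction)
  open +-*-Solver

  geometric : ℕ → ℕ → ℕ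
  geometric r zero    = 0
  geometric r (suc n) = r ^ n + geometric r n

  geometric-*-pred : ∀ r n → geometric r n * (r ∸ 1) ≡ r ^ n ∸ 1
  geometric-*-pred zero    zero    = refl
  geometric-*-pred zero    (suc n) = *-zeroʳ (geometric 0 (suc n))
  geometric-*-pred (suc p) n       = sym (trans (cong (_∸ 1) (sym (telescope n))) (m+n∸n≡m _ 1))
    where
    telescope : ∀ n → geometric (suc p) n * p + 1 ≡ suc p ^ n
    telescope zero    = refl
    telescope (suc n) = begin
      (suc p ^ n + geometric (suc p) n) * p + 1       ≡⟨ solve 3 (λ a g p → (a :+ g) :* p :+ con 1 := a :* p :+ (g :* p :+ con 1))
                                                                refl (suc p ^ n) (geometric (suc p) n) p ⟩
      suc p ^ n * p + (geometric (suc p) n * p + 1)   ≡⟨ cong (suc p ^ n * p +_) (telescope n) ⟩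
      suc p ^ n * p + suc p ^ n                       ≡⟨ solve 2 (λ a p → a :* p :+ a := (con 1 :+ p) :* a) refl (suc p ^ n) p ⟩
      suc p * suc p ^ n                               ∎
      where open ≡-Reasoning

  pow-geometric : ∀ r a b → r ^ a * geometric r b * (r ∸ 1) ≡ r ^ a * (r ^ b ∸ 1)
  pow-geometric r a b = trans (*-assoc (r ^ a) _ _) (cong (r ^ a *_) (geometric-*-pred r b))

  pow-split : ∀ r a b X → X * (r ∸ 1) + r ^ a ≡ r ^ (a + b) → X * (r ∸ 1) ≡ r ^ a * (r ^ b ∸ 1)
  pow-split r a b X eq = begin
    X * (r ∸ 1)                  ≡⟨ m+n∸n≡m (X * (r ∸ 1)) (r ^ a) ⟨
    X * (r ∸ 1) + r ^ a ∸ r ^ a  ≡⟨ cong (_∸ r ^ a) (trans eq (^-distribˡ-+-* r a b)) ⟩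
    r ^ a * r ^ b ∸ r ^ a        ≡⟨ cong (r ^ a * r ^ b ∸_) (*-identityʳ (r ^ a)) ⟨
    r ^ a * r ^ b ∸ r ^ a * 1    ≡⟨ *-distribˡ-∸ (r ^ a) (r ^ b) 1 ⟨
    r ^ a * (r ^ b ∸ 1)          ∎
    where open ≡-Reasoning

  *-pow-cancel : ∀ r c k X .{{_ : NonZero r}} → X * r ^ k * (r ∸ 1) ≡ r ^ (c + k) * (r ^ k ∸ 1) →
    X * (r ∸ 1) ≡ r ^ (c + k) ∸ r ^ c
  *-pow-cancel r c k X eq = *-cancelʳ-≡ _ _ (r ^ k) {{m^n≢0 r k}} (begin
    X * (r ∸ 1) * r ^ k                    ≡⟨ solve 3 (λ x p s → x :* p :* s := x :* s :* p) refl X (r ∸ 1) (r ^ k) ⟩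
    X * r ^ k * (r ∸ 1)                    ≡⟨ eq ⟩
    r ^ (c + k) * (r ^ k ∸ 1)              ≡⟨ *-distribˡ-∸ (r ^ (c + k)) (r ^ k) 1 ⟩
    r ^ (c + k) * r ^ k ∸ r ^ (c + k) * 1  ≡⟨ cong (r ^ (c + k) * r ^ k ∸_) (trans (*-identityʳ _) (^-distribˡ-+-* r c k)) ⟩
    r ^ (c + k) * r ^ k ∸ r ^ c * r ^ k    ≡⟨ *-distribʳ-∸ (r ^ k) (r ^ (c + k)) (r ^ c) ⟨
    (r ^ (c + k) ∸ r ^ c) * r ^ k          ∎)
    where open ≡-Reasoning

  *-∸1-cancel : ∀ r {X Y} → 1 < r → X * (r ∸ 1) ≡ Y * (r ∸ 1) → X ≡ Y
  *-∸1-cancel r 1<r = *-cancelʳ-≡ _ _ (r ∸ 1) {{>-nonZero (m<n⇒0<n∸m 1<r)}}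

  ^-cancelʳ-≤ : ∀ r {a b} → 1 < r → r ^ a ≤ r ^ b → a ≤ b
  ^-cancelʳ-≤ r {a} {b} 1<r le with ≤-<-connex a b
  ... | inj₁ a≤b = a≤b
  ... | inj₂ b<a = contradiction le (<⇒≱ (^-monoʳ-< r 1<r b<a))

  ^-cancelʳ-< : ∀ r {a b} .{{_ : NonZero r}} → r ^ a < r ^ b → a < b
  ^-cancelʳ-< r {a} {b} lt with ≤-<-connex b a
  ... | inj₁ b≤a = contradiction (^-monoʳ-≤ r b≤a) (<⇒≱ lt)
  ... | inj₂ a<b = a<b

  ∸-+-comm : ∀ m a k → m ∸ (a + k) ≡ m ∸ k ∸ a
  ∸-+-comm m a k = trans (cong (m ∸_) (+-comm a k)) (sym (∸-+-assoc m k a))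

  ∸-+-cancel : ∀ m a k → a + k ≤ m → m ∸ (a + k) + k ≡ m ∸ a
  ∸-+-cancel m a k le = begin
    m ∸ (a + k) + k  ≡⟨ cong (_+ k) (∸-+-assoc m a k) ⟨
    m ∸ a ∸ k + k    ≡⟨ m∸n+n≡m (m+n≤o⇒m≤o∸n k (subst (_≤ m) (+-comm a k) le)) ⟩
    m ∸ a            ∎
    where open ≡-Reasoning

  ∸-+-cancel-pred : ∀ m k → 1 ≤ k → 1 + k ≤ m → m ∸ (1 + k) + (k ∸ 1) ≡ m ∸ 2
  ∸-+-cancel-pred m (suc k) _ le = ∸-+-cancel m 2 k le

module Linear {q : ℕ} (F : FiniteField q) where

  open import Level using (0ℓ)
  open import Data.Bool using (if_then_else_)
  open import Data.Nat using (zero; suc; _<_; z<s; s≤s; z≤n; NonZero; >-nonZero)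
  open import Data.Nat.Properties using (<-trans)
  open import Data.Fin using (Fin)
  import Data.Fin as Fin
  open import Data.Vec using (Vec; []; _∷_; zipWith; map; replicate)
  open import Data.Vec.Properties
    using (zipWith-assoc; zipWith-comm; zipWith-identityˡ; zipWith-identityʳ; map-cong; map-id; map-∘; map-const)
  open import Data.Product using (proj₁; proj₂)
  open import Function.Bundles using (_⇔_; mk⇔)
  open import Relation.Binary.PropositionalEquality
  open import Relation.Nullary using (¬_; contradiction; yes; no; does)
  open import Algebra.Structures using (IsCommutativeRing)
  open import Algebra.Bundles using (CommutativeRing)

  open FiniteField F
  open IsCommutativeRing isCommutativeRing
    using (+-assoc; +-comm; +-identityˡ; +-identityʳ; -‿inverseʳ; *-assoc; *-comm; *-identityˡ; *-identityʳ;
           distribˡ; distribʳ; zeroˡ; zeroʳ)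

  private
    ring : CommutativeRing 0ℓ 0ℓ
    ring = record { isCommutativeRing = isCommutativeRing }

  open import Algebra.Properties.Ring (CommutativeRing.ring ring) using (-1*x≈-x)

  1<q : 1 < q
  1<q = distinct⇒1< 0# 1# 0≢1
    where
    distinct⇒1< : ∀ {n} (a b : Fin n) → ¬ a ≡ b → 1 < n
    distinct⇒1< {suc zero}    Fin.zero Fin.zero a≢b = contradiction refl a≢b
    distinct⇒1< {suc (suc n)} _        _        _   = s≤s (s≤s z≤n)

  instance
    q-nonZero : NonZero q
    q-nonZero = >-nonZero (<-trans z<s 1<q)

  inv : ∀ c → ¬ c ≡ 0# → Fin q
  inv c c≢0 = proj₁ (inverse c c≢0)

  inv-inverseʳ : ∀ c (c≢0 : ¬ c ≡ 0#) → c * inv c c≢0 ≡ 1#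
  inv-inverseʳ c c≢0 = proj₂ (inverse c c≢0)

  inv-inverseˡ : ∀ c (c≢0 : ¬ c ≡ 0#) → inv c c≢0 * c ≡ 1#
  inv-inverseˡ c c≢0 = trans (*-comm _ c) (inv-inverseʳ c c≢0)

  *-cancelˡ-nonzero : ∀ {c a b} → ¬ c ≡ 0# → c * a ≡ c * b → a ≡ b
  *-cancelˡ-nonzero {c} {a} {b} c≢0 eq = begin
    a                    ≡⟨ *-identityˡ a ⟨
    1# * a               ≡⟨ cong (_* a) (inv-inverseˡ c c≢0) ⟨
    (inv c c≢0 * c) * a  ≡⟨ *-assoc _ c a ⟩
    inv c c≢0 * (c * a)  ≡⟨ cong (inv c c≢0 *_) eq ⟩
    inv c c≢0 * (c * b)  ≡⟨ *-assoc _ c b ⟨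
    (inv c c≢0 * c) * b  ≡⟨ cong (_* b) (inv-inverseˡ c c≢0) ⟩
    1# * b               ≡⟨ *-identityˡ b ⟩
    b                    ∎
    where open ≡-Reasoning

  *-nonzero : ∀ {a b} → ¬ a ≡ 0# → ¬ b ≡ 0# → ¬ a * b ≡ 0#
  *-nonzero {a} a≢0 b≢0 ab≡0 = b≢0 (*-cancelˡ-nonzero a≢0 (trans ab≡0 (sym (zeroʳ a))))

  *-≡-self : ∀ {c a} → ¬ c ≡ 0# → (c * a ≡ c) ⇔ (a ≡ 1#)
  *-≡-self {c} c≢0 = mk⇔ (λ ca≡c → *-cancelˡ-nonzero c≢0 (trans ca≡c (sym (*-identityʳ c))))
                         (λ { refl → *-identityʳ c })

  -1# : Fin q
  -1# = - 1#

  -1≢0 : ¬ -1# ≡ 0#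
  -1≢0 -1≡0 = 0≢1 (begin
    0#         ≡⟨ -‿inverseʳ 1# ⟨
    1# + -1#   ≡⟨ cong (1# +_) -1≡0 ⟩
    1# + 0#    ≡⟨ +-identityʳ 1# ⟩
    1#         ∎)
    where open ≡-Reasoning

  infixl 6 _⊕_
  infixr 7 _⊙_

  _⊕_ : ∀ {n} → Vec (Fin q) n → Vec (Fin q) n → Vec (Fin q) n
  _⊕_ = zipWith _+_

  _⊙_ : ∀ {n} → Fin q → Vec (Fin q) n → Vec (Fin q) n
  c ⊙ v = map (c *_) v

  𝟎 : ∀ n → Vec (Fin q) n
  𝟎 n = replicate n 0#

  ⊕-assoc : ∀ {n} (u v w : Vec (Fin q) n) → (u ⊕ v) ⊕ w ≡ u ⊕ (v ⊕ w)
  ⊕-assoc = zipWith-assoc +-assoc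

  ⊕-comm : ∀ {n} (u v : Vec (Fin q) n) → u ⊕ v ≡ v ⊕ u
  ⊕-comm = zipWith-comm +-comm

  ⊕-identityˡ : ∀ {n} (v : Vec (Fin q) n) → 𝟎 n ⊕ v ≡ v
  ⊕-identityˡ = zipWith-identityˡ +-identityˡ

  ⊕-identityʳ : ∀ {n} (v : Vec (Fin q) n) → v ⊕ 𝟎 n ≡ v
  ⊕-identityʳ = zipWith-identityʳ +-identityʳ

  ⊕-interchange : ∀ {n} (a b c d : Vec (Fin q) n) → (a ⊕ b) ⊕ (c ⊕ d) ≡ (a ⊕ c) ⊕ (b ⊕ d)
  ⊕-interchange {n} a b c d = begin
    (a ⊕ b) ⊕ (c ⊕ d)  ≡⟨ ⊕-assoc a b (c ⊕ d) ⟩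
    a ⊕ (b ⊕ (c ⊕ d))  ≡⟨ cong (a ⊕_) (⊕-assoc b c d) ⟨
    a ⊕ ((b ⊕ c) ⊕ d)  ≡⟨ cong (λ x → a ⊕ (x ⊕ d)) (⊕-comm b c) ⟩
    a ⊕ ((c ⊕ b) ⊕ d)  ≡⟨ cong (a ⊕_) (⊕-assoc c b d) ⟩
    a ⊕ (c ⊕ (b ⊕ d))  ≡⟨ ⊕-assoc a c (b ⊕ d) ⟨
    (a ⊕ c) ⊕ (b ⊕ d)  ∎
    where open ≡-Reasoning

  ⊙-identityˡ : ∀ {n} (v : Vec (Fin q) n) → 1# ⊙ v ≡ v
  ⊙-identityˡ v = trans (map-cong *-identityˡ v) (map-id v)

  ⊙-zeroˡ : ∀ {n} (v : Vec (Fin q) n) → 0# ⊙ v ≡ 𝟎 n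
  ⊙-zeroˡ v = trans (map-cong zeroˡ v) (map-const v 0#)

  ⊙-zeroʳ : ∀ n c → c ⊙ 𝟎 n ≡ 𝟎 n
  ⊙-zeroʳ zero    c = refl
  ⊙-zeroʳ (suc n) c = cong₂ _∷_ (zeroʳ c) (⊙-zeroʳ n c)

  ⊙-assoc : ∀ {n} c d (v : Vec (Fin q) n) → (c * d) ⊙ v ≡ c ⊙ d ⊙ v
  ⊙-assoc c d v = trans (map-cong (*-assoc c d) v) (map-∘ (c *_) (d *_) v)

  ⊙-distribˡ : ∀ {n} c (u v : Vec (Fin q) n) → c ⊙ (u ⊕ v) ≡ c ⊙ u ⊕ c ⊙ v
  ⊙-distribˡ c []      []      = refl
  ⊙-distribˡ c (a ∷ u) (b ∷ v) = cong₂ _∷_ (distribˡ c a b) (⊙-distribˡ c u v)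

  ⊙-distribʳ : ∀ {n} c d (v : Vec (Fin q) n) → (c + d) ⊙ v ≡ c ⊙ v ⊕ d ⊙ v
  ⊙-distribʳ c d []      = refl
  ⊙-distribʳ c d (a ∷ v) = cong₂ _∷_ (distribʳ a c d) (⊙-distribʳ c d v)

  ⊕-inverseʳ : ∀ {n} (v : Vec (Fin q) n) → v ⊕ -1# ⊙ v ≡ 𝟎 n
  ⊕-inverseʳ []      = refl
  ⊕-inverseʳ (a ∷ v) = cong₂ _∷_ (trans (cong (a +_) (-1*x≈-x a)) (-‿inverseʳ a)) (⊕-inverseʳ v)

  ⊕-inverse-cancel : ∀ {n} (u v : Vec (Fin q) n) → (u ⊕ v) ⊕ -1# ⊙ v ≡ u
  ⊕-inverse-cancel {n} u v = begin
    (u ⊕ v) ⊕ -1# ⊙ v  ≡⟨ ⊕-assoc u v _ ⟩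
    u ⊕ (v ⊕ -1# ⊙ v)  ≡⟨ cong (u ⊕_) (⊕-inverseʳ v) ⟩
    u ⊕ 𝟎 n            ≡⟨ ⊕-identityʳ u ⟩
    u                  ∎
    where open ≡-Reasoning

  ⊕-inverse-≡𝟎 : ∀ {n} (u v : Vec (Fin q) n) → u ⊕ -1# ⊙ v ≡ 𝟎 n → u ≡ v
  ⊕-inverse-≡𝟎 {n} u v eq = begin
    u                  ≡⟨ ⊕-inverse-cancel u v ⟨
    (u ⊕ v) ⊕ -1# ⊙ v  ≡⟨ cong (_⊕ -1# ⊙ v) (⊕-comm u v) ⟩
    (v ⊕ u) ⊕ -1# ⊙ v  ≡⟨ ⊕-assoc v u _ ⟩
    v ⊕ (u ⊕ -1# ⊙ v)  ≡⟨ cong (v ⊕_) eq ⟩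
    v ⊕ 𝟎 n            ≡⟨ ⊕-identityʳ v ⟩
    v                  ∎
    where open ≡-Reasoning

  inv-⊙-cancel : ∀ {n} c (c≢0 : ¬ c ≡ 0#) (v : Vec (Fin q) n) → inv c c≢0 ⊙ c ⊙ v ≡ v
  inv-⊙-cancel c c≢0 v = begin
    inv c c≢0 ⊙ c ⊙ v    ≡⟨ ⊙-assoc _ c v ⟨
    (inv c c≢0 * c) ⊙ v  ≡⟨ cong (_⊙ v) (inv-inverseˡ c c≢0) ⟩
    1# ⊙ v               ≡⟨ ⊙-identityˡ v ⟩
    v                    ∎
    where open ≡-Reasoning

  ⊙-inv-cancel : ∀ {n} c (c≢0 : ¬ c ≡ 0#) (v : Vec (Fin q) n) → c ⊙ inv c c≢0 ⊙ v ≡ v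
  ⊙-inv-cancel c c≢0 v = begin
    c ⊙ inv c c≢0 ⊙ v    ≡⟨ ⊙-assoc c _ v ⟨
    (c * inv c c≢0) ⊙ v  ≡⟨ cong (_⊙ v) (inv-inverseʳ c c≢0) ⟩
    1# ⊙ v               ≡⟨ ⊙-identityˡ v ⟩
    v                    ∎
    where open ≡-Reasoning

  lead : ∀ {n} → Vec (Fin q) n → Fin q
  lead []      = 0#
  lead (a ∷ v) = if does (a Fin.≟ 0#) then lead v else a

  lead-⊙ : ∀ {n} c → ¬ c ≡ 0# → (v : Vec (Fin q) n) → lead (c ⊙ v) ≡ c * lead v
  lead-⊙ c c≢0 []      = sym (zeroʳ c)
  lead-⊙ c c≢0 (a ∷ v) with a Fin.≟ 0# | (c * a) Fin.≟ 0#
  ... | yes _    | yes _    = lead-⊙ c c≢0 v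
  ... | yes refl | no ca≢0  = contradiction (zeroʳ c) ca≢0
  ... | no  a≢0  | yes ca≡0 = contradiction ca≡0 (*-nonzero c≢0 a≢0)
  ... | no  _    | no  _    = refl

  lead≡0 : ∀ {n} (v : Vec (Fin q) n) → lead v ≡ 0# → v ≡ 𝟎 n
  lead≡0 []      _ = refl
  lead≡0 (a ∷ v) lead≡0# with a Fin.≟ 0#
  ... | yes refl = cong (0# ∷_) (lead≡0 v lead≡0#)
  ... | no  a≢0  = contradiction lead≡0# a≢0

module Spans {q : ℕ} (F : FiniteField q) (m : ℕ) where

  open import Data.Bool using (true; false; _∧_; not)
  open import Data.Bool.Properties using (⇔→≡; ∧-conicalʳ)
  open import Data.Bool.ListAction using (any)
  open import Data.Nat using (zero; suc; _+_; _*_; _^_; _<_)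
  import Data.Nat.Properties as ℕ
  open import Data.Fin using (Fin)
  import Data.Fin.Properties as Fin
  open import Data.Vec using (Vec; []; _∷_; _++_)
  import Data.Vec.Properties as Vec
  open import Data.Vec.Relation.Unary.All using (All; []; _∷_)
  open import Data.Vec.Relation.Unary.All.Properties using (++⁻)
  import Data.Vec.Relation.Unary.All as All
  open import Data.List using (List; length; map; allFin; cartesianProductWith; concatMap)
  import Data.List as List
  import Data.List.Properties as List
  open import Data.List.Membership.Propositional using () renaming (_∈_ to _∈ₗ_)
  open import Data.List.Membership.Propositional.Properties
    using (∈-allFin; ∈-cartesianProductWith⁺; ∈-map⁺; ∈-map⁻)
  open import Data.List.Relation.Unary.Any using (here)
  import Data.List.Relation.Unary.All as ListAll
  import Data.List.Relation.Unary.AllPairs as AllPairs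
  open import Data.List.Relation.Unary.Unique.Propositional using (Unique)
  import Data.List.Relation.Unary.Unique.Propositional.Properties as Unique
  open import Data.Product using (∃; _,_; proj₁)
  open import Function.Bundles using (_⇔_; mk⇔; Equivalence)
  open import Relation.Binary.PropositionalEquality
  open import Relation.Nullary using (¬_; yes; no; contradiction)
  open import Relation.Nullary.Decidable using (dec-true)

  open Counting
  open Arithmetic
  open FiniteField F using (0#; 1#)
  open Linear F
  open Geometry F m

  allVecs-cartesian : ∀ n → allVecs (suc n) ≡ cartesianProductWith _∷_ (allFin q) (allVecs n)
  allVecs-cartesian n = go (allFin q)
    where
    go : ∀ as → concatMap (λ a → map (a ∷_) (allVecs n)) as ≡ cartesianProductWith _∷_ as (allVecs n)
    go List.[]       = refl
    go (a List.∷ as) = cong (map (a ∷_) (allVecs n) List.++_) (go as)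

  allVecs-complete : ∀ n (v : Vec (Fin q) n) → v ∈ₗ allVecs n
  allVecs-complete zero    []      = here refl
  allVecs-complete (suc n) (a ∷ v) rewrite allVecs-cartesian n =
    ∈-cartesianProductWith⁺ _∷_ (∈-allFin a) (allVecs-complete n v)

  allVecs-unique : ∀ n → Unique (allVecs n)
  allVecs-unique zero    = ListAll.[] AllPairs.∷ AllPairs.[]
  allVecs-unique (suc n) rewrite allVecs-cartesian n =
    Unique.cartesianProductWith⁺ _∷_ Vec.∷-injective (Unique.allFin⁺ q) (allVecs-unique n)

  length-allVecs : ∀ n → length (allVecs n) ≡ q ^ n
  length-allVecs zero    = refl
  length-allVecs (suc n) rewrite allVecs-cartesian n =
    trans (length-cartesianProductWith _∷_ (allFin q) (allVecs n))
          (cong₂ _*_ (List.length-tabulate {n = q} (λ i → i)) (length-allVecs n))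

  -- Defs' count P unfolds to countIn vectors P, so the countIn lemmas apply to count directly.
  vectors : List V
  vectors = allVecs m

  open Enumeration vectors (allVecs-complete m) public
    using (satisfiable?; countIn-pos; countIn-<-length; countIn-≡-length; countIn-∘-inverse)

  count-≤ : ∀ P → count P ≤ q ^ m
  count-≤ P = subst (count P ≤_) (length-allVecs m) (countIn-≤-length vectors P)

  ==-⇔ : ∀ {u v : V} → (u == v) ≡ true ⇔ u ≡ v
  ==-⇔ {u} {v} = mk⇔ (does-true⇒ (Vec.≡-dec Fin._≟_ u v)) (dec-true (Vec.≡-dec Fin._≟_ u v))

  ⊆-difference : ∀ {U W : Pred} → ¬ (∃ λ v → (U v ∧ not (W v)) ≡ true) → U ⊆ W
  ⊆-difference {U} {W} none v v∈U with W v in Wv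
  ... | true  = refl
  ... | false = contradiction (v , ∧-intro v∈U (cong not Wv)) none

  lincomb-𝟎 : ∀ {a} (bs : Vec V a) → lincomb (𝟎 a) bs ≡ 𝟎 m
  lincomb-𝟎 []       = refl
  lincomb-𝟎 (b ∷ bs) = trans (cong₂ _⊕_ (⊙-zeroˡ b) (lincomb-𝟎 bs)) (⊕-identityˡ (𝟎 m))

  lincomb-⊕ : ∀ {a} (cs ds : Vec (Fin q) a) bs → lincomb (cs ⊕ ds) bs ≡ lincomb cs bs ⊕ lincomb ds bs
  lincomb-⊕ []       []       []       = sym (⊕-identityˡ (𝟎 m))
  lincomb-⊕ (c ∷ cs) (d ∷ ds) (b ∷ bs) =
    trans (cong₂ _⊕_ (⊙-distribʳ c d b) (lincomb-⊕ cs ds bs)) (⊕-interchange (c ⊙ b) (d ⊙ b) _ _)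

  lincomb-⊙ : ∀ {a} c (cs : Vec (Fin q) a) bs → lincomb (c ⊙ cs) bs ≡ c ⊙ lincomb cs bs
  lincomb-⊙ c []       []       = sym (⊙-zeroʳ m c)
  lincomb-⊙ c (d ∷ cs) (b ∷ bs) =
    trans (cong₂ _⊕_ (⊙-assoc c d b) (lincomb-⊙ c cs bs)) (sym (⊙-distribˡ c (d ⊙ b) _))

  -- Opaque: spans are only used through ∈⟨⟩⇔, and stay rigid enough to be inferred as implicit arguments.
  opaque
    ⟨_⟩ : ∀ {a} → Vec V a → Pred
    ⟨ bs ⟩ v = any (λ cs → v == lincomb cs bs) (allVecs _)

  opaque
    unfolding ⟨_⟩

    ∈⟨⟩⇔ : ∀ {a} (bs : Vec V a) {v} → v ∈ ⟨ bs ⟩ ⇔ ∃ λ cs → v ≡ lincomb cs bs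
    ∈⟨⟩⇔ {a} bs = mk⇔
      (λ v∈ → let cs , eq = Equivalence.to any-⇔ v∈ in cs , Equivalence.to ==-⇔ eq)
      (λ (cs , eq) → Equivalence.from any-⇔ (cs , Equivalence.from ==-⇔ eq))
      where open Enumeration (allVecs a) (allVecs-complete a) using (any-⇔)

  lincomb∈⟨⟩ : ∀ {a} (bs : Vec V a) cs → lincomb cs bs ∈ ⟨ bs ⟩
  lincomb∈⟨⟩ bs cs = Equivalence.from (∈⟨⟩⇔ bs) (cs , refl)

  ⟨⟩-subspace : ∀ {a} (bs : Vec V a) → IsSubspace ⟨ bs ⟩
  ⟨⟩-subspace {a} bs = record
    { zero∈    = Equivalence.from (∈⟨⟩⇔ bs) (𝟎 a , sym (lincomb-𝟎 bs))
    ; +-closed = λ u v u∈ v∈ →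
        let cs , u≡ = Equivalence.to (∈⟨⟩⇔ bs) u∈ ; ds , v≡ = Equivalence.to (∈⟨⟩⇔ bs) v∈ in
        Equivalence.from (∈⟨⟩⇔ bs) (cs ⊕ ds , trans (cong₂ _⊕_ u≡ v≡) (sym (lincomb-⊕ cs ds bs)))
    ; ·-closed = λ c v v∈ →
        let cs , v≡ = Equivalence.to (∈⟨⟩⇔ bs) v∈ in
        Equivalence.from (∈⟨⟩⇔ bs) (c ⊙ cs , trans (cong (c ⊙_) v≡) (sym (lincomb-⊙ c cs bs)))
    }

  lincomb∈subspace : ∀ {U a} → IsSubspace U → {bs : Vec V a} → All (_∈ U) bs → ∀ cs → lincomb cs bs ∈ U
  lincomb∈subspace U-sub []         []       = IsSubspace.zero∈ U-sub
  lincomb∈subspace U-sub (b∈ ∷ bs∈) (c ∷ cs) =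
    IsSubspace.+-closed U-sub _ _ (IsSubspace.·-closed U-sub c _ b∈) (lincomb∈subspace U-sub bs∈ cs)

  ⟨⟩-least : ∀ {U a} → IsSubspace U → {bs : Vec V a} → All (_∈ U) bs → ⟨ bs ⟩ ⊆ U
  ⟨⟩-least U-sub {bs} bs∈ v v∈ with Equivalence.to (∈⟨⟩⇔ bs) v∈
  ... | cs , refl = lincomb∈subspace U-sub bs∈ cs

  ⟨⟩-head : ∀ {a} b (bs : Vec V a) → b ∈ ⟨ b ∷ bs ⟩
  ⟨⟩-head {a} b bs = Equivalence.from (∈⟨⟩⇔ (b ∷ bs)) (1# ∷ 𝟎 a ,
    sym (trans (cong₂ _⊕_ (⊙-identityˡ b) (lincomb-𝟎 bs)) (⊕-identityʳ b)))

  ⟨⟩-tail : ∀ {a} b (bs : Vec V a) → ⟨ bs ⟩ ⊆ ⟨ b ∷ bs ⟩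
  ⟨⟩-tail b bs v v∈ with Equivalence.to (∈⟨⟩⇔ bs) v∈
  ... | cs , refl = Equivalence.from (∈⟨⟩⇔ (b ∷ bs)) (0# ∷ cs ,
    sym (trans (cong (_⊕ lincomb cs bs) (⊙-zeroˡ b)) (⊕-identityˡ _)))

  ⟨⟩-generators : ∀ {a} (bs : Vec V a) → All (_∈ ⟨ bs ⟩) bs
  ⟨⟩-generators []       = []
  ⟨⟩-generators (b ∷ bs) = ⟨⟩-head b bs ∷ All.map (λ {v} → ⟨⟩-tail b bs v) (⟨⟩-generators bs)

  ⟨⟩-++ˡ : ∀ {a b} (A : Vec V a) (B : Vec V b) → ⟨ A ⟩ ⊆ ⟨ A ++ B ⟩
  ⟨⟩-++ˡ A B = ⟨⟩-least (⟨⟩-subspace (A ++ B)) (proj₁ (++⁻ A (⟨⟩-generators (A ++ B))))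

  ⟨∷⟩-mono : ∀ {a} {x y} {L : Vec V a} → y ∈ ⟨ x ∷ L ⟩ → ⟨ y ∷ L ⟩ ⊆ ⟨ x ∷ L ⟩
  ⟨∷⟩-mono {x = x} {L = L} y∈ =
    ⟨⟩-least (⟨⟩-subspace (x ∷ L)) (y∈ ∷ All.map (λ {w} → ⟨⟩-tail x L w) (⟨⟩-generators L))

  ⟨⟩-absorb : ∀ {a} {x y} {L : Vec V a} → y ∈ ⟨ x ∷ L ⟩ → ⟨ x ∷ y ∷ L ⟩ ≗ ⟨ x ∷ L ⟩
  ⟨⟩-absorb {x = x} {y} {L} y∈ v = ⇔→≡ (mk⇔
    (⟨⟩-least (⟨⟩-subspace (x ∷ L))
      (⟨⟩-head x L ∷ y∈ ∷ All.map (λ {w} → ⟨⟩-tail x L w) (⟨⟩-generators L)) v)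
    (⟨⟩-least (⟨⟩-subspace (x ∷ y ∷ L))
      (⟨⟩-head x (y ∷ L) ∷ All.map (λ {w} w∈ → ⟨⟩-tail x (y ∷ L) w (⟨⟩-tail y L w w∈)) (⟨⟩-generators L)) v))

  subspace-solve : ∀ {S} → IsSubspace S → ∀ c (c≢0 : ¬ c ≡ 0#) x l → (c ⊙ x ⊕ l) ∈ S → l ∈ S → x ∈ S
  subspace-solve {S} S-sub c c≢0 x l y∈ l∈ = subst (_∈ S) x≡
    (IsSubspace.·-closed S-sub _ _ (IsSubspace.+-closed S-sub _ _ y∈ (IsSubspace.·-closed S-sub -1# l l∈)))
    where
    x≡ : inv c c≢0 ⊙ ((c ⊙ x ⊕ l) ⊕ -1# ⊙ l) ≡ x
    x≡ = trans (cong (inv c c≢0 ⊙_) (⊕-inverse-cancel (c ⊙ x) l)) (inv-⊙-cancel c c≢0 x)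

  ⟨⟩-exchange : ∀ {a} {x y} {bs : Vec V a} → y ∈ ⟨ x ∷ bs ⟩ → ¬ y ∈ ⟨ bs ⟩ → x ∈ ⟨ y ∷ bs ⟩
  ⟨⟩-exchange {x = x} {y} {bs} y∈ y∉ with Equivalence.to (∈⟨⟩⇔ (x ∷ bs)) y∈
  ... | c ∷ cs , y≡ with c Fin.≟ 0#
  ...   | yes refl = contradiction (subst (_∈ ⟨ bs ⟩) (sym y≡′) (lincomb∈⟨⟩ bs cs)) y∉
    where y≡′ = trans y≡ (trans (cong (_⊕ lincomb cs bs) (⊙-zeroˡ x)) (⊕-identityˡ _))
  ...   | no  c≢0  = subspace-solve (⟨⟩-subspace (y ∷ bs)) c c≢0 x (lincomb cs bs)
      (subst (_∈ ⟨ y ∷ bs ⟩) y≡ (⟨⟩-head y bs)) (⟨⟩-tail y bs (lincomb cs bs) (lincomb∈⟨⟩ bs cs))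

  Independent : ∀ {a} → Vec V a → Set
  Independent {a} bs = ∀ cs → lincomb cs bs ≡ 𝟎 m → cs ≡ 𝟎 a

  independent-[] : Independent []
  independent-[] [] _ = refl

  independent-tail : ∀ {a} {b} {bs : Vec V a} → Independent (b ∷ bs) → Independent bs
  independent-tail {b = b} ind cs eq =
    Vec.∷-injectiveʳ (ind (0# ∷ cs) (trans (cong₂ _⊕_ (⊙-zeroˡ b) eq) (⊕-identityˡ (𝟎 m))))

  independent-head : ∀ {a} {b} {bs : Vec V a} → Independent (b ∷ bs) → ¬ b ∈ ⟨ bs ⟩
  independent-head {b = b} {bs} ind b∈ with Equivalence.to (∈⟨⟩⇔ bs) b∈
  ... | cs , b≡ = -1≢0 (Vec.∷-injectiveˡ (ind (-1# ∷ cs) (begin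
    -1# ⊙ b ⊕ lincomb cs bs  ≡⟨ cong (-1# ⊙ b ⊕_) b≡ ⟨
    -1# ⊙ b ⊕ b              ≡⟨ ⊕-comm _ b ⟩
    b ⊕ -1# ⊙ b              ≡⟨ ⊕-inverseʳ b ⟩
    𝟎 m                      ∎)))
    where open ≡-Reasoning

  independent-∷ : ∀ {a} {b} {bs : Vec V a} → Independent bs → ¬ b ∈ ⟨ bs ⟩ → Independent (b ∷ bs)
  independent-∷ {b = b} {bs} ind b∉ (c ∷ cs) eq with c Fin.≟ 0#
  ... | yes refl = cong (0# ∷_) (ind cs (trans (sym (trans (cong (_⊕ lincomb cs bs) (⊙-zeroˡ b)) (⊕-identityˡ _))) eq))
  ... | no  c≢0  = contradiction (subspace-solve (⟨⟩-subspace bs) c c≢0 b (lincomb cs bs)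
      (subst (_∈ ⟨ bs ⟩) (sym eq) (IsSubspace.zero∈ (⟨⟩-subspace bs))) (lincomb∈⟨⟩ bs cs)) b∉

  independent-++ˡ : ∀ {a b} (A : Vec V a) {B : Vec V b} → Independent (A ++ B) → Independent A
  independent-++ˡ []      _       = independent-[]
  independent-++ˡ (x ∷ A) {B} ind = independent-∷ (independent-++ˡ A (independent-tail ind))
    (λ x∈⟨A⟩ → independent-head ind (⟨⟩-++ˡ A B x x∈⟨A⟩))

  lincomb-injective : ∀ {a} {bs : Vec V a} → Independent bs → ∀ cs ds → lincomb cs bs ≡ lincomb ds bs → cs ≡ ds
  lincomb-injective {bs = bs} ind cs ds eq = ⊕-inverse-≡𝟎 cs ds (ind _ (begin
    lincomb (cs ⊕ -1# ⊙ ds) bs             ≡⟨ lincomb-⊕ cs _ bs ⟩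
    lincomb cs bs ⊕ lincomb (-1# ⊙ ds) bs  ≡⟨ cong₂ _⊕_ eq (lincomb-⊙ -1# ds bs) ⟩
    lincomb ds bs ⊕ -1# ⊙ lincomb ds bs    ≡⟨ ⊕-inverseʳ _ ⟩
    𝟎 m                                    ∎))
    where open ≡-Reasoning

  count-⟨⟩ : ∀ {a} {bs : Vec V a} → Independent bs → count ⟨ bs ⟩ ≡ q ^ a
  count-⟨⟩ {a} {bs} ind = begin
    count ⟨ bs ⟩         ≡⟨ countIn-≡-length (allVecs-unique m) combinations-unique
                                             (mk⇔ combination⇒∈ ∈⇒combination) ⟩
    length combinations  ≡⟨ List.length-map (λ cs → lincomb cs bs) (allVecs a) ⟩
    length (allVecs a)   ≡⟨ length-allVecs a ⟩
    q ^ a                ∎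
    where
    open ≡-Reasoning
    combinations : List V
    combinations = map (λ cs → lincomb cs bs) (allVecs a)
    combinations-unique : Unique combinations
    combinations-unique = Unique.map⁺ (lincomb-injective ind _ _) (allVecs-unique a)
    combination⇒∈ : ∀ {v} → v ∈ₗ combinations → v ∈ ⟨ bs ⟩
    combination⇒∈ v∈ with ∈-map⁻ (λ cs → lincomb cs bs) v∈
    ... | cs , _ , refl = lincomb∈⟨⟩ bs cs
    ∈⇒combination : ∀ {v} → v ∈ ⟨ bs ⟩ → v ∈ₗ combinations
    ∈⇒combination v∈ with Equivalence.to (∈⟨⟩⇔ bs) v∈
    ... | cs , refl = ∈-map⁺ (λ cs → lincomb cs bs) (allVecs-complete a cs)

  independent-≤ : ∀ {a} {bs : Vec V a} → Independent bs → a ≤ m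
  independent-≤ ind = ^-cancelʳ-≤ q 1<q (subst (_≤ q ^ m) (count-⟨⟩ ind) (count-≤ _))

  outside-⟨⟩ : ∀ {a} {bs : Vec V a} → Independent bs → a < m → ∃ λ v → ¬ v ∈ ⟨ bs ⟩
  outside-⟨⟩ {a} {bs} ind a<m = countIn-<-length ⟨ bs ⟩ (begin-strict
    count ⟨ bs ⟩    ≡⟨ count-⟨⟩ ind ⟩
    q ^ a           <⟨ ℕ.^-monoʳ-< q 1<q a<m ⟩
    q ^ m           ≡⟨ length-allVecs m ⟨
    length vectors  ∎)
    where open ℕ.≤-Reasoning

  -- Greedy basis extension; the fuel e is the dimension still available in F^m.
  count-subspace : ∀ {W} → IsSubspace W → ∃ λ d → count W ≡ q ^ d
  count-subspace {W} W-sub = extend m [] (ℕ.+-identityʳ m) independent-[] []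
    where
    extend : ∀ e {a} (bs : Vec V a) → e + a ≡ m → Independent bs → All (_∈ W) bs → ∃ λ d → count W ≡ q ^ d
    extend e {a} bs e+a≡m ind bs⊆W with satisfiable? (λ v → W v ∧ not (⟨ bs ⟩ v))
    ... | no none = a , trans (countIn-cong vectors W≗⟨bs⟩) (count-⟨⟩ ind)
      where
      W≗⟨bs⟩ : W ≗ ⟨ bs ⟩
      W≗⟨bs⟩ v = ⇔→≡ (mk⇔ (⊆-difference {W} {⟨ bs ⟩} none v) (⟨⟩-least W-sub bs⊆W v))
    ... | yes (w , w∈W∖⟨bs⟩) with w∈W , w∉⟨bs⟩ ← ∧-not-elim {W w} {⟨ bs ⟩ w} w∈W∖⟨bs⟩ | e
    ...   | zero   = contradiction (independent-≤ (independent-∷ ind w∉⟨bs⟩))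
                                   (ℕ.<⇒≱ (ℕ.≤-reflexive (cong suc (sym e+a≡m))))
    ...   | suc e′ = extend e′ (w ∷ bs) (trans (ℕ.+-suc e′ a) e+a≡m) (independent-∷ ind w∉⟨bs⟩) (w∈W ∷ bs⊆W)

  count-proper-subspace : ∀ {U W} → IsSubspace U → IsSubspace W → U ⊆ W → ∀ w → w ∈ W → ¬ w ∈ U →
    count U * q ≤ count W
  count-proper-subspace {U} {W} U-sub W-sub U⊆W w w∈W w∉U
    with a , #U ← count-subspace U-sub | b , #W ← count-subspace W-sub = begin
    count U * q  ≡⟨ cong (_* q) #U ⟩
    q ^ a * q    ≡⟨ ℕ.*-comm (q ^ a) q ⟩
    q ^ suc a    ≤⟨ ℕ.^-monoʳ-≤ q (^-cancelʳ-< q {a} {b} (subst₂ _<_ #U #W U<W)) ⟩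
    q ^ b        ≡⟨ #W ⟨
    count W      ∎
    where
    open ℕ.≤-Reasoning
    U≗W∧U : U ≗ λ v → W v ∧ U v
    U≗W∧U v = ⇔→≡ (mk⇔ (λ v∈U → ∧-intro (U⊆W v v∈U) v∈U) (∧-conicalʳ _ _))
    U<W : count U < count W
    U<W = begin-strict
      count U                                                  ≡⟨ countIn-cong vectors U≗W∧U ⟩
      count (λ v → W v ∧ U v)
        <⟨ ℕ.m<m+n _ (countIn-pos {x = w} (∧-intro w∈W (not-intro w∉U))) ⟩
      count (λ v → W v ∧ U v) + count (λ v → W v ∧ not (U v))  ≡⟨ countIn-split vectors W U ⟨
      count W                                                  ∎

  subspace-≗ : ∀ {U W} → U ≗ W → IsSubspace W → IsSubspace U
  subspace-≗ {U} {W} U≗W W-sub = record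
    { zero∈    = trans (U≗W _) (IsSubspace.zero∈ W-sub)
    ; +-closed = λ u v u∈ v∈ →
        trans (U≗W _) (IsSubspace.+-closed W-sub u v (trans (sym (U≗W u)) u∈) (trans (sym (U≗W v)) v∈))
    ; ·-closed = λ c v v∈ → trans (U≗W _) (IsSubspace.·-closed W-sub c v (trans (sym (U≗W v)) v∈))
    }

  subspace-scale : ∀ {U} → IsSubspace U → ∀ c → ¬ c ≡ 0# → ∀ v → U (c ⊙ v) ≡ U v
  subspace-scale {U} U-sub c c≢0 v = ⇔→≡ (mk⇔
    (λ cv∈ → subst (_∈ U) (inv-⊙-cancel c c≢0 v) (IsSubspace.·-closed U-sub (inv c c≢0) _ cv∈))
    (IsSubspace.·-closed U-sub c v))

module Points {q : ℕ} (F : FiniteField q) (m : ℕ) where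

  open import Data.Bool using (true; _∧_; not)
  open import Data.Bool.Properties using (⇔→≡; ∧-conicalˡ; ∧-conicalʳ; ∧-comm)
  open import Data.Nat using (zero; suc; _+_; _*_; _∸_)
  import Data.Nat.Properties as ℕ
  open import Data.Fin using (Fin)
  import Data.Fin.Properties as Fin
  open import Data.Vec using (Vec; []; _∷_)
  open import Data.List using (allFin)
  open import Data.List.Membership.Propositional.Properties using (∈-allFin)
  open import Data.Product using (∃; _,_)
  open import Function using (_∘_)
  open import Function.Bundles using (_⇔_; mk⇔; Equivalence)
  open import Relation.Binary.PropositionalEquality
  open import Relation.Nullary using (¬_; yes; no; does; contradiction)
  open import Relation.Nullary.Decidable using (dec-true; dec-false; does-⇔)
  open import Algebra.Structures using (IsCommutativeRing)
  open import Algebra.Properties.CommutativeMonoid.Sum ℕ.+-0-commutativeMonoid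
    using () renaming (sum-syntax to ∑-syntax)

  open Counting
  open FiniteField F using (0#; 1#; 0≢1; isCommutativeRing) renaming (_*_ to _*ᶠ_)
  open IsCommutativeRing isCommutativeRing using (*-identityʳ)
  open Linear F
  open Geometry F m
  open Spans F m

  isPoint-lead : ∀ {n} (v : Vec (Fin q) n) → normalised v ≡ does (lead v Fin.≟ 1#)
  isPoint-lead []      = sym (dec-false (0# Fin.≟ 1#) 0≢1)
  isPoint-lead (a ∷ v) with a Fin.≟ 0#
  ... | yes _ = isPoint-lead v
  ... | no  _ = refl

  lead-𝟎 : ∀ n → lead (𝟎 n) ≡ 0#
  lead-𝟎 zero    = refl
  lead-𝟎 (suc n) rewrite dec-true (0# Fin.≟ 0#) refl = lead-𝟎 n

  point-lead : ∀ {v} → isPoint v ≡ true → lead v ≡ 1#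
  point-lead {v} v-point = does-true⇒ (lead v Fin.≟ 1#) (trans (sym (isPoint-lead v)) v-point)

  point-nonzero : ∀ {v} → isPoint v ≡ true → ¬ v ≡ 𝟎 m
  point-nonzero {v} v-point refl = 0≢1 (trans (sym (lead-𝟎 m)) (point-lead {v} v-point))

  -- The nonzero vectors of D fall into q − 1 fibres of the leading coefficient,
  -- and scaling by c maps the normalised ones onto the fibre over c.
  count-cone : ∀ (D : Pred) → ¬ 𝟎 m ∈ D → (∀ c → ¬ c ≡ 0# → ∀ v → D (c ⊙ v) ≡ D v) →
    count D ≡ count (λ v → isPoint v ∧ D v) * (q ∸ 1)
  count-cone D 𝟎∉D D-cone = begin
    count D                                  ≡⟨ countIn-fibres vectors lead D ⟩
    ∑[ c < q ] count (fibre c)               ≡⟨ ∑-hole (count ∘ fibre) 0# fibre-0 fibre-nonzero ⟩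
    (q ∸ 1) * count (λ v → isPoint v ∧ D v)  ≡⟨ ℕ.*-comm (q ∸ 1) _ ⟩
    count (λ v → isPoint v ∧ D v) * (q ∸ 1)  ∎
    where
    open ≡-Reasoning
    fibre : Fin q → Pred
    fibre c v = D v ∧ does (lead v Fin.≟ c)
    fibre-0 : count (fibre 0#) ≡ 0
    fibre-0 = countIn-none vectors λ v v∈ →
      𝟎∉D (subst (_∈ D) (lead≡0 v (does-true⇒ (lead v Fin.≟ 0#) (∧-conicalʳ _ _ v∈))) (∧-conicalˡ _ _ v∈))
    fibre-nonzero : ∀ c → ¬ c ≡ 0# → count (fibre c) ≡ count (λ v → isPoint v ∧ D v)
    fibre-nonzero c c≢0 = begin
      count (fibre c)                ≡⟨ countIn-∘-inverse (allVecs-unique m) (fibre c) (c ⊙_) (inv c c≢0 ⊙_)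
                                                          (⊙-inv-cancel c c≢0) (inv-⊙-cancel c c≢0) ⟨
      count (λ v → fibre c (c ⊙ v))  ≡⟨ countIn-cong vectors scaled ⟩
      count (λ v → isPoint v ∧ D v)  ∎
      where
      scaled : ∀ v → fibre c (c ⊙ v) ≡ (isPoint v ∧ D v)
      scaled v = begin
        D (c ⊙ v) ∧ does (lead (c ⊙ v) Fin.≟ c)
          ≡⟨ cong₂ (λ d l → d ∧ does (l Fin.≟ c)) (D-cone c c≢0 v) (lead-⊙ c c≢0 v) ⟩
        D v ∧ does ((c *ᶠ lead v) Fin.≟ c)
          ≡⟨ cong (D v ∧_) (does-⇔ (*-≡-self c≢0) ((c *ᶠ lead v) Fin.≟ c) (lead v Fin.≟ 1#)) ⟩
        D v ∧ does (lead v Fin.≟ 1#)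
          ≡⟨ cong (D v ∧_) (isPoint-lead v) ⟨
        D v ∧ isPoint v
          ≡⟨ ∧-comm (D v) _ ⟩
        isPoint v ∧ D v
          ∎

  count-points-between : ∀ {U W} → IsSubspace U → IsSubspace W → W ⊆ U →
    count (λ v → isPoint v ∧ (U v ∧ not (W v))) * (q ∸ 1) + count W ≡ count U
  count-points-between {U} {W} U-sub W-sub W⊆U = begin
    count (λ v → isPoint v ∧ (U v ∧ not (W v))) * (q ∸ 1) + count W
      ≡⟨ cong₂ _+_ (sym (count-cone _ 𝟎∉U∖W U∖W-cone)) (countIn-cong vectors W≗U∧W) ⟩
    count (λ v → U v ∧ not (W v)) + count (λ v → U v ∧ W v)
      ≡⟨ ℕ.+-comm (count (λ v → U v ∧ not (W v))) _ ⟩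
    count (λ v → U v ∧ W v) + count (λ v → U v ∧ not (W v))
      ≡⟨ countIn-split vectors U W ⟨
    count U
      ∎
    where
    open ≡-Reasoning
    𝟎∉U∖W : ¬ 𝟎 m ∈ (λ v → U v ∧ not (W v))
    𝟎∉U∖W 𝟎∈ = not-elim (∧-conicalʳ _ _ 𝟎∈) (IsSubspace.zero∈ W-sub)
    U∖W-cone : ∀ c → ¬ c ≡ 0# → ∀ v → (U (c ⊙ v) ∧ not (W (c ⊙ v))) ≡ (U v ∧ not (W v))
    U∖W-cone c c≢0 v = cong₂ (λ u w → u ∧ not w) (subspace-scale U-sub c c≢0 v) (subspace-scale W-sub c c≢0 v)
    W≗U∧W : W ≗ λ v → U v ∧ W v
    W≗U∧W v = ⇔→≡ (mk⇔ (λ w∈ → ∧-intro (W⊆U v w∈) w∈) (∧-conicalʳ _ _))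

  ∈⟨singleton⟩⇔ : ∀ x {v} → v ∈ ⟨ x ∷ [] ⟩ ⇔ ∃ λ c → v ≡ c ⊙ x
  ∈⟨singleton⟩⇔ x {v} = mk⇔
    (λ v∈ → coefficient (Equivalence.to (∈⟨⟩⇔ (x ∷ [])) v∈))
    (λ (c , v≡) → Equivalence.from (∈⟨⟩⇔ (x ∷ [])) (c ∷ [] , trans v≡ (sym (⊕-identityʳ (c ⊙ x)))))
    where
    coefficient : (∃ λ cs → v ≡ lincomb cs (x ∷ [])) → ∃ λ c → v ≡ c ⊙ x
    coefficient (c ∷ [] , v≡) = c , trans v≡ (⊕-identityʳ (c ⊙ x))

  span≗⟨⟩ : ∀ x → span x ≗ ⟨ x ∷ [] ⟩
  span≗⟨⟩ x v = ⇔→≡ (mk⇔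
    (λ v∈ → let c , v≡ = Equivalence.to scalars v∈ in
            Equivalence.from (∈⟨singleton⟩⇔ x) (c , Equivalence.to ==-⇔ v≡))
    (λ v∈ → let c , v≡ = Equivalence.to (∈⟨singleton⟩⇔ x) v∈ in
            Equivalence.from scalars (c , Equivalence.from ==-⇔ v≡)))
    where scalars = Enumeration.any-⇔ (allFin q) ∈-allFin {λ c → v == c ⊙ x}

  point-independent : ∀ {x} → isPoint x ≡ true → Independent (x ∷ [])
  point-independent {x} x-point = independent-∷ independent-[] λ x∈ → point-nonzero {x} x-point (∈⟨[]⟩⇒≡𝟎 x∈)
    where
    ∈⟨[]⟩⇒≡𝟎 : ∀ {v} → v ∈ ⟨ [] ⟩ → v ≡ 𝟎 m
    ∈⟨[]⟩⇒≡𝟎 v∈ with Equivalence.to (∈⟨⟩⇔ []) v∈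
    ... | [] , v≡ = v≡

  distinct-points-independent : ∀ {x y} → isPoint x ≡ true → isPoint y ≡ true → ¬ x ≡ y →
    Independent (x ∷ y ∷ [])
  distinct-points-independent {x} {y} x-point y-point x≢y = independent-∷ (point-independent y-point) λ x∈ →
    let c , x≡ = Equivalence.to (∈⟨singleton⟩⇔ y) x∈ in
    x≢y (trans x≡ (trans (cong (_⊙ y) (c≡1 c x≡)) (⊙-identityˡ y)))
    where
    c≡1 : ∀ c → x ≡ c ⊙ y → c ≡ 1#
    c≡1 c x≡ with c Fin.≟ 0#
    ... | yes refl = contradiction (trans x≡ (⊙-zeroˡ y)) (point-nonzero {x} x-point)
    ... | no  c≢0  = begin
      c             ≡⟨ *-identityʳ c ⟨
      c *ᶠ 1#       ≡⟨ cong (c *ᶠ_) (point-lead {y} y-point) ⟨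
      c *ᶠ lead y   ≡⟨ lead-⊙ c c≢0 y ⟨
      lead (c ⊙ y)  ≡⟨ cong lead x≡ ⟨
      lead x        ≡⟨ point-lead {x} x-point ⟩
      1#            ∎
      where open ≡-Reasoning

module Polarities {q : ℕ} (F : FiniteField q) (m : ℕ) (ζ : Geometry.Pred F m → Geometry.Pred F m)
                  (isPolarity : Geometry.IsPolarity F m ζ) where

  open import Data.Bool using (true; _∧_; not)
  open import Data.Bool.Properties using (⇔→≡; ∧-conicalˡ; ∧-conicalʳ)
  open import Data.Nat using (zero; suc; _+_; _*_; _^_; _∸_; _<_; s≤s)
  import Data.Nat.Properties as ℕ
  open import Data.Vec using (Vec; []; _∷_; _++_)
  open import Data.Vec.Relation.Unary.All using (All; []; _∷_)
  import Data.Vec.Relation.Unary.All as All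
  open import Data.Vec.Relation.Unary.All.Properties using (++⁺; ++⁻)
  open import Data.Product using (_,_; proj₁; proj₂)
  open import Function.Bundles using (mk⇔)
  open import Relation.Binary.PropositionalEquality
  open import Relation.Nullary using (yes; no; contradiction)

  open Counting
  open Linear F
  open Geometry F m
  open Spans F m
  open Points F m
  open IsPolarity isPolarity

  full-subspace : IsSubspace (λ _ → true)
  full-subspace = record { zero∈ = refl ; +-closed = λ _ _ _ _ → refl ; ·-closed = λ _ _ _ → refl }

  ∧-subspace : ∀ {U W} → IsSubspace U → IsSubspace W → IsSubspace (λ v → U v ∧ W v)
  ∧-subspace U-sub W-sub = record
    { zero∈    = ∧-intro (IsSubspace.zero∈ U-sub) (IsSubspace.zero∈ W-sub)
    ; +-closed = λ u v u∈ v∈ → ∧-intro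
        (IsSubspace.+-closed U-sub u v (∧-conicalˡ _ _ u∈) (∧-conicalˡ _ _ v∈))
        (IsSubspace.+-closed W-sub u v (∧-conicalʳ _ _ u∈) (∧-conicalʳ _ _ v∈))
    ; ·-closed = λ c v v∈ → ∧-intro
        (IsSubspace.·-closed U-sub c v (∧-conicalˡ _ _ v∈))
        (IsSubspace.·-closed W-sub c v (∧-conicalʳ _ _ v∈))
    }

  ζ⟨⟩-subspace : ∀ {a} (bs : Vec V a) → IsSubspace (ζ ⟨ bs ⟩)
  ζ⟨⟩-subspace bs = subspace↦subspace ⟨ bs ⟩ (⟨⟩-subspace bs)

  ζ-cong : ∀ {U W} → IsSubspace U → IsSubspace W → U ≗ W → ζ U ≗ ζ W
  ζ-cong {U} {W} U-sub W-sub U≗W v = ⇔→≡ (mk⇔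
    (reversing W U W-sub U-sub (λ x x∈W → trans (U≗W x) x∈W) v)
    (reversing U W U-sub W-sub (λ x x∈U → trans (sym (U≗W x)) x∈U) v))

  ⊆ζ-swap : ∀ {U W} → IsSubspace U → IsSubspace W → U ⊆ ζ W → W ⊆ ζ U
  ⊆ζ-swap {U} {W} U-sub W-sub U⊆ζW v v∈W =
    reversing U (ζ W) U-sub (subspace↦subspace W W-sub) U⊆ζW v (trans (involutive W W-sub v) v∈W)

  perp≗ζ⟨⟩ : ∀ x → perp ζ x ≗ ζ ⟨ x ∷ [] ⟩
  perp≗ζ⟨⟩ x = ζ-cong (subspace-≗ (span≗⟨⟩ x) (⟨⟩-subspace (x ∷ []))) (⟨⟩-subspace (x ∷ [])) (span≗⟨⟩ x)

  ζ⟨[]⟩ : ∀ v → v ∈ ζ ⟨ [] ⟩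
  ζ⟨[]⟩ v = ⊆ζ-swap (⟨⟩-subspace []) full-subspace (⟨⟩-least (subspace↦subspace _ full-subspace) []) v refl

  ζ⟨++⟩ : ∀ {a b} (A : Vec V a) (B : Vec V b) → ζ ⟨ A ++ B ⟩ ≗ λ v → ζ ⟨ A ⟩ v ∧ ζ ⟨ B ⟩ v
  ζ⟨++⟩ A B v = ⇔→≡ (mk⇔
    (λ v∈ → ∧-intro (shrink A (proj₁ generators) v v∈) (shrink B (proj₂ generators) v v∈))
    (⊆ζ-swap (⟨⟩-subspace (A ++ B)) T-subspace
      (⟨⟩-least (subspace↦subspace T T-subspace) (++⁺ (ζT-contains A (λ _ → ∧-conicalˡ _ _))
                                                        (ζT-contains B (λ _ → ∧-conicalʳ _ _)))) v))
    where
    generators = ++⁻ A (⟨⟩-generators (A ++ B))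
    shrink : ∀ {c} (C : Vec V c) → All (_∈ ⟨ A ++ B ⟩) C → ζ ⟨ A ++ B ⟩ ⊆ ζ ⟨ C ⟩
    shrink C C⊆ = reversing ⟨ C ⟩ ⟨ A ++ B ⟩ (⟨⟩-subspace C) (⟨⟩-subspace (A ++ B))
                            (⟨⟩-least (⟨⟩-subspace (A ++ B)) C⊆)
    T : Pred
    T v = ζ ⟨ A ⟩ v ∧ ζ ⟨ B ⟩ v
    T-subspace : IsSubspace T
    T-subspace = ∧-subspace (ζ⟨⟩-subspace A) (ζ⟨⟩-subspace B)
    ζT-contains : ∀ {c} (C : Vec V c) → T ⊆ ζ ⟨ C ⟩ → All (_∈ ζ T) C
    ζT-contains C T⊆ζ⟨C⟩ = All.map (λ {x} → ⊆ζ-swap T-subspace (⟨⟩-subspace C) T⊆ζ⟨C⟩ x) (⟨⟩-generators C)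

  -- The inclusion ζ⟨b ∷ bs⟩ ⊆ ζ⟨bs⟩ is proper: otherwise applying ζ again would put b in ⟨bs⟩.
  ζ⟨∷⟩-shrinks : ∀ {a} {b} {bs : Vec V a} → Independent (b ∷ bs) →
    count (ζ ⟨ b ∷ bs ⟩) * q ≤ count (ζ ⟨ bs ⟩)
  ζ⟨∷⟩-shrinks {b = b} {bs} ind with satisfiable? (λ v → ζ ⟨ bs ⟩ v ∧ not (ζ ⟨ b ∷ bs ⟩ v))
  ... | yes (w , w∈) = let w∈ζ⟨bs⟩ , w∉ζ⟨b∷bs⟩ = ∧-not-elim {ζ ⟨ bs ⟩ w} w∈ in
    count-proper-subspace (ζ⟨⟩-subspace (b ∷ bs)) (ζ⟨⟩-subspace bs)
      (reversing _ _ (⟨⟩-subspace bs) (⟨⟩-subspace (b ∷ bs)) (⟨⟩-tail b bs)) w w∈ζ⟨bs⟩ w∉ζ⟨b∷bs⟩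
  ... | no none = contradiction (trans (sym (involutive _ (⟨⟩-subspace bs) b)) (⟨b∷bs⟩⊆ζζ⟨bs⟩ b (⟨⟩-head b bs)))
                                (independent-head ind)
    where
    ⟨b∷bs⟩⊆ζζ⟨bs⟩ : ⟨ b ∷ bs ⟩ ⊆ ζ (ζ ⟨ bs ⟩)
    ⟨b∷bs⟩⊆ζζ⟨bs⟩ = ⊆ζ-swap (ζ⟨⟩-subspace bs) (⟨⟩-subspace (b ∷ bs))
                            (⊆-difference {ζ ⟨ bs ⟩} {ζ ⟨ b ∷ bs ⟩} none)

  -- Each independent vector shrinks ζ⟨bs⟩ by a factor q at least; walking from ⟨[]⟩ up to bs,
  -- and from bs up to a basis of F^m, bounds count (ζ ⟨ bs ⟩) from both sides.
  count-ζ⟨⟩ : ∀ {a} {bs : Vec V a} → Independent bs → count (ζ ⟨ bs ⟩) ≡ q ^ (m ∸ a)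
  count-ζ⟨⟩ {a} {bs} ind = ℕ.≤-antisym
    (ℕ.*-cancelʳ-≤ _ _ (q ^ a) {{ℕ.m^n≢0 q a}} (ℕ.≤-trans (upper ind) (ℕ.≤-reflexive (sym q^[m∸a]*q^a))))
    (lower (m ∸ a) (ℕ.m∸n+n≡m (independent-≤ ind)) ind)
    where
    open ℕ.≤-Reasoning
    q^[m∸a]*q^a : q ^ (m ∸ a) * q ^ a ≡ q ^ m
    q^[m∸a]*q^a = trans (sym (ℕ.^-distribˡ-+-* q (m ∸ a) a)) (cong (q ^_) (ℕ.m∸n+n≡m (independent-≤ ind)))
    upper : ∀ {a} {bs : Vec V a} → Independent bs → count (ζ ⟨ bs ⟩) * q ^ a ≤ q ^ m
    upper {bs = []}     _   = ℕ.≤-trans (ℕ.≤-reflexive (ℕ.*-identityʳ _)) (count-≤ _)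
    upper {suc a} {b ∷ bs} ind = begin
      count (ζ ⟨ b ∷ bs ⟩) * (q * q ^ a)  ≡⟨ ℕ.*-assoc (count (ζ ⟨ b ∷ bs ⟩)) q (q ^ a) ⟨
      count (ζ ⟨ b ∷ bs ⟩) * q * q ^ a    ≤⟨ ℕ.*-monoˡ-≤ (q ^ a) (ζ⟨∷⟩-shrinks ind) ⟩
      count (ζ ⟨ bs ⟩) * q ^ a            ≤⟨ upper (independent-tail ind) ⟩
      q ^ m                               ∎
    lower : ∀ e {a} {bs : Vec V a} → e + a ≡ m → Independent bs → q ^ e ≤ count (ζ ⟨ bs ⟩)
    lower zero    {bs = bs} _ _ = countIn-pos {x = 𝟎 m} (IsSubspace.zero∈ (ζ⟨⟩-subspace bs))
    lower (suc e) {a} {bs} e+a≡m ind with w , w∉ ← outside-⟨⟩ ind (subst (a <_) e+a≡m (s≤s (ℕ.m≤n+m a e))) = begin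
      q * q ^ e                 ≡⟨ ℕ.*-comm q (q ^ e) ⟩
      q ^ e * q                 ≤⟨ ℕ.*-monoˡ-≤ q (lower e (trans (ℕ.+-suc e a) e+a≡m) (independent-∷ ind w∉)) ⟩
      count (ζ ⟨ w ∷ bs ⟩) * q  ≤⟨ ζ⟨∷⟩-shrinks (independent-∷ ind w∉) ⟩
      count (ζ ⟨ bs ⟩)          ∎

module PolarGraph {q : ℕ} (F : FiniteField q) (m : ℕ) (ζ : Geometry.Pred F m → Geometry.Pred F m)
                  (isPolarity : Geometry.IsPolarity F m ζ) (k : ℕ) (1≤k : 1 ≤ k)
                  (π : Geometry.Pred F m) (π-subspace : Geometry.IsSubspace F m π)
                  (π-dim : Geometry.HasDim F m π k) (π-isotropic : Geometry._⊆_ F m π (ζ π)) where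

  open import Data.Bool using (Bool; true; false; _∧_; not)
  open import Data.Bool.Properties using (⇔→≡; ∧-conicalˡ; ∧-conicalʳ; ∧-identityʳ; ∧-zeroʳ)
  open import Data.Nat using (suc; _+_; _*_; _^_; _∸_; NonZero; >-nonZero; >-nonZero⁻¹)
  import Data.Nat.Properties as ℕ
  open import Data.Fin using (Fin)
  import Data.Fin as Fin
  open import Data.Vec using (Vec; []; _∷_; _++_)
  open import Data.Vec.Relation.Unary.All using (_∷_)
  import Data.Vec.Relation.Unary.All as All
  open import Data.Product using (∃; _,_; proj₁; proj₂)
  open import Function.Bundles using (mk⇔; Equivalence)
  open import Relation.Binary.PropositionalEquality
  open import Relation.Nullary using (¬_; does)
  open import Relation.Nullary.Decidable using (dec-true)
  open import Algebra.Properties.CommutativeMonoid.Sum ℕ.+-0-commutativeMonoid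
    using (sum-cong-≗) renaming (sum-syntax to ∑-syntax)

  open Counting
  open Arithmetic
  open Linear F
  open Geometry F m
  open Spans F m
  open Points F m
  open Polarities F m ζ isPolarity
  open IsPolarity isPolarity

  bs : Vec V k
  bs = proj₁ π-dim

  bs-independent : Independent bs
  bs-independent = proj₁ (proj₂ (proj₂ π-dim))

  π≗⟨bs⟩ : π ≗ ⟨ bs ⟩
  π≗⟨bs⟩ v = ⇔→≡ (mk⇔
    (λ v∈ → Equivalence.from (∈⟨⟩⇔ bs) (proj₂ (proj₂ (proj₂ π-dim)) v v∈))
    (λ v∈ → let cs , v≡ = Equivalence.to (∈⟨⟩⇔ bs) v∈ in subst (_∈ π) (sym v≡) (proj₁ (proj₂ π-dim) cs)))

  ζπ≗ζ⟨bs⟩ : ζ π ≗ ζ ⟨ bs ⟩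
  ζπ≗ζ⟨bs⟩ = ζ-cong π-subspace (⟨⟩-subspace bs) π≗⟨bs⟩

  ⟨bs⟩⊆ζπ : ⟨ bs ⟩ ⊆ ζ π
  ⟨bs⟩⊆ζπ v v∈ = π-isotropic v (trans (π≗⟨bs⟩ v) v∈)

  vertex : Pred
  vertex = isVertex ζ π

  vertex-point : ∀ {x} → x ∈ vertex → isPoint x ≡ true
  vertex-point = ∧-conicalˡ _ _

  vertex∉ζπ : ∀ {x} → x ∈ vertex → ¬ x ∈ ζ π
  vertex∉ζπ x∈ = not-elim (∧-conicalʳ _ _ x∈)

  vertex∉⟨bs⟩ : ∀ {x} → x ∈ vertex → ¬ x ∈ ⟨ bs ⟩
  vertex∉⟨bs⟩ {x} x∈ x∈⟨bs⟩ = vertex∉ζπ {x} x∈ (⟨bs⟩⊆ζπ x x∈⟨bs⟩)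

  vertex-independent : ∀ {x} → x ∈ vertex → Independent (x ∷ bs)
  vertex-independent {x} x∈ = independent-∷ bs-independent (vertex∉⟨bs⟩ {x} x∈)

  adjacentToAll : ∀ {a} → Vec V a → Pred
  adjacentToAll []      z = true
  adjacentToAll (x ∷ A) z = adj ζ x z ∧ adjacentToAll A z

  adjacentToAll≗ζ⟨⟩ : ∀ {a} (A : Vec V a) → adjacentToAll A ≗ ζ ⟨ A ⟩
  adjacentToAll≗ζ⟨⟩ []      z = sym (ζ⟨[]⟩ z)
  adjacentToAll≗ζ⟨⟩ (x ∷ A) z =
    trans (cong₂ _∧_ (perp≗ζ⟨⟩ x z) (adjacentToAll≗ζ⟨⟩ A z)) (sym (ζ⟨++⟩ (x ∷ []) A z))

  count-common-neighbours : ∀ {a} (A : Vec V a) →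
    count (λ z → vertex z ∧ adjacentToAll A z) * (q ∸ 1) + count (ζ ⟨ A ++ bs ⟩) ≡ count (ζ ⟨ A ⟩)
  count-common-neighbours A = begin
    count (λ z → vertex z ∧ adjacentToAll A z) * (q ∸ 1) + count (ζ ⟨ A ++ bs ⟩)
      ≡⟨ cong (λ n → n * (q ∸ 1) + count (ζ ⟨ A ++ bs ⟩)) (countIn-cong vectors as-difference) ⟩
    count (λ z → isPoint z ∧ (ζ ⟨ A ⟩ z ∧ not (ζ ⟨ A ++ bs ⟩ z))) * (q ∸ 1) + count (ζ ⟨ A ++ bs ⟩)
      ≡⟨ count-points-between (ζ⟨⟩-subspace A) (ζ⟨⟩-subspace (A ++ bs))
                              (λ z z∈ → ∧-conicalˡ _ _ (trans (sym (ζ⟨++⟩ A bs z)) z∈)) ⟩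
    count (ζ ⟨ A ⟩)
      ∎
    where
    open ≡-Reasoning
    difference : ∀ p a b → (p ∧ not b) ∧ a ≡ p ∧ (a ∧ not (a ∧ b))
    difference false _     _ = refl
    difference true  false b = ∧-zeroʳ (not b)
    difference true  true  b = ∧-identityʳ (not b)
    as-difference : ∀ z → (vertex z ∧ adjacentToAll A z) ≡ (isPoint z ∧ (ζ ⟨ A ⟩ z ∧ not (ζ ⟨ A ++ bs ⟩ z)))
    as-difference z = begin
      (isPoint z ∧ not (ζ π z)) ∧ adjacentToAll A z
        ≡⟨ cong₂ (λ b a → (isPoint z ∧ not b) ∧ a) (ζπ≗ζ⟨bs⟩ z) (adjacentToAll≗ζ⟨⟩ A z) ⟩
      (isPoint z ∧ not (ζ ⟨ bs ⟩ z)) ∧ ζ ⟨ A ⟩ z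
        ≡⟨ difference (isPoint z) (ζ ⟨ A ⟩ z) (ζ ⟨ bs ⟩ z) ⟩
      isPoint z ∧ (ζ ⟨ A ⟩ z ∧ not (ζ ⟨ A ⟩ z ∧ ζ ⟨ bs ⟩ z))
        ≡⟨ cong (λ b → isPoint z ∧ (ζ ⟨ A ⟩ z ∧ not b)) (ζ⟨++⟩ A bs z) ⟨
      isPoint z ∧ (ζ ⟨ A ⟩ z ∧ not (ζ ⟨ A ++ bs ⟩ z))
        ∎

  count-common-neighbours-independent : ∀ {a} (A : Vec V a) → Independent (A ++ bs) →
    count (λ z → vertex z ∧ adjacentToAll A z) * (q ∸ 1) ≡ q ^ (m ∸ (a + k)) * (q ^ k ∸ 1)
  count-common-neighbours-independent {a} A ind = pow-split q (m ∸ (a + k)) k X (begin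
    X * (q ∸ 1) + q ^ (m ∸ (a + k))      ≡⟨ cong (X * (q ∸ 1) +_) (count-ζ⟨⟩ ind) ⟨
    X * (q ∸ 1) + count (ζ ⟨ A ++ bs ⟩)  ≡⟨ count-common-neighbours A ⟩
    count (ζ ⟨ A ⟩)                      ≡⟨ count-ζ⟨⟩ (independent-++ˡ A ind) ⟩
    q ^ (m ∸ a)                          ≡⟨ cong (q ^_) (∸-+-cancel m a k (independent-≤ ind)) ⟨
    q ^ (m ∸ (a + k) + k)                ∎)
    where
    open ≡-Reasoning
    X = count (λ z → vertex z ∧ adjacentToAll A z)

  count-vertices : count vertex * (q ∸ 1) ≡ q ^ (m ∸ k) * (q ^ k ∸ 1)
  count-vertices = trans (cong (_* (q ∸ 1)) (countIn-cong vectors λ z → sym (∧-identityʳ (vertex z))))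
                         (count-common-neighbours-independent [] bs-independent)

  degree : ∀ {x} → x ∈ vertex → count (λ y → vertex y ∧ adj ζ x y) * (q ∸ 1) ≡ q ^ (m ∸ k ∸ 1) * (q ^ k ∸ 1)
  degree {x} x∈ = begin
    count (λ y → vertex y ∧ adj ζ x y) * (q ∸ 1)
      ≡⟨ cong (_* (q ∸ 1)) (countIn-cong vectors λ y → cong (vertex y ∧_) (sym (∧-identityʳ (adj ζ x y)))) ⟩
    count (λ y → vertex y ∧ adjacentToAll (x ∷ []) y) * (q ∸ 1)
      ≡⟨ count-common-neighbours-independent (x ∷ []) (vertex-independent {x} x∈) ⟩
    q ^ (m ∸ (1 + k)) * (q ^ k ∸ 1)
      ≡⟨ cong (λ e → q ^ e * (q ^ k ∸ 1)) (∸-+-comm m 1 k) ⟩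
    q ^ (m ∸ k ∸ 1) * (q ^ k ∸ 1)
      ∎
    where open ≡-Reasoning

  common≗adjacentToAll : ∀ x y →
    (λ z → vertex z ∧ (adj ζ x z ∧ adj ζ y z)) ≗ λ z → vertex z ∧ adjacentToAll (x ∷ y ∷ []) z
  common≗adjacentToAll x y z = cong (λ b → vertex z ∧ (adj ζ x z ∧ b)) (sym (∧-identityʳ (adj ζ y z)))

  common-apart : ∀ {x y} → x ∈ vertex → y ∈ vertex → ¬ x ∈ ⟨ y ∷ bs ⟩ →
    count (λ z → vertex z ∧ (adj ζ x z ∧ adj ζ y z)) * (q ∸ 1) ≡ q ^ (m ∸ k ∸ 2) * (q ^ k ∸ 1)
  common-apart {x} {y} x∈ y∈ x∉ = begin
    count (λ z → vertex z ∧ (adj ζ x z ∧ adj ζ y z)) * (q ∸ 1)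
      ≡⟨ cong (_* (q ∸ 1)) (countIn-cong vectors (common≗adjacentToAll x y)) ⟩
    count (λ z → vertex z ∧ adjacentToAll (x ∷ y ∷ []) z) * (q ∸ 1)
      ≡⟨ count-common-neighbours-independent (x ∷ y ∷ []) (independent-∷ (vertex-independent {y} y∈) x∉) ⟩
    q ^ (m ∸ (2 + k)) * (q ^ k ∸ 1)
      ≡⟨ cong (λ e → q ^ e * (q ^ k ∸ 1)) (∸-+-comm m 2 k) ⟩
    q ^ (m ∸ k ∸ 2) * (q ^ k ∸ 1)
      ∎
    where open ≡-Reasoning

  common-together : ∀ {x y} → x ∈ vertex → y ∈ vertex → ¬ x ≡ y → y ∈ ⟨ x ∷ bs ⟩ →
    count (λ z → vertex z ∧ (adj ζ x z ∧ adj ζ y z)) * (q ∸ 1) ≡ q ^ (m ∸ k ∸ 1) * (q ^ (k ∸ 1) ∸ 1)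
  common-together {x} {y} x∈ y∈ x≢y y∈⟨x∷bs⟩ = begin
    X * (q ∸ 1)                            ≡⟨ pow-split q (m ∸ (1 + k)) (k ∸ 1) X X*[q∸1]+q^[m∸[1+k]] ⟩
    q ^ (m ∸ (1 + k)) * (q ^ (k ∸ 1) ∸ 1)  ≡⟨ cong (λ e → q ^ e * (q ^ (k ∸ 1) ∸ 1)) (∸-+-comm m 1 k) ⟩
    q ^ (m ∸ k ∸ 1) * (q ^ (k ∸ 1) ∸ 1)    ∎
    where
    open ≡-Reasoning
    X = count (λ z → vertex z ∧ (adj ζ x z ∧ adj ζ y z))
    ζ⟨x∷bs⟩≗ : ζ ⟨ x ∷ bs ⟩ ≗ ζ ⟨ x ∷ y ∷ bs ⟩
    ζ⟨x∷bs⟩≗ = ζ-cong (⟨⟩-subspace (x ∷ bs)) (⟨⟩-subspace (x ∷ y ∷ bs))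
                      (λ v → sym (⟨⟩-absorb y∈⟨x∷bs⟩ v))
    X*[q∸1]+q^[m∸[1+k]] : X * (q ∸ 1) + q ^ (m ∸ (1 + k)) ≡ q ^ (m ∸ (1 + k) + (k ∸ 1))
    X*[q∸1]+q^[m∸[1+k]] = begin
      X * (q ∸ 1) + q ^ (m ∸ (1 + k))
        ≡⟨ cong (X * (q ∸ 1) +_) (count-ζ⟨⟩ (vertex-independent {x} x∈)) ⟨
      X * (q ∸ 1) + count (ζ ⟨ x ∷ bs ⟩)
        ≡⟨ cong₂ (λ n c → n * (q ∸ 1) + c) (countIn-cong vectors (common≗adjacentToAll x y))
                                           (countIn-cong vectors ζ⟨x∷bs⟩≗) ⟩
      count (λ z → vertex z ∧ adjacentToAll (x ∷ y ∷ []) z) * (q ∸ 1) + count (ζ ⟨ x ∷ y ∷ bs ⟩)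
        ≡⟨ count-common-neighbours (x ∷ y ∷ []) ⟩
      count (ζ ⟨ x ∷ y ∷ [] ⟩)
        ≡⟨ count-ζ⟨⟩ (distinct-points-independent (vertex-point {x} x∈) (vertex-point {y} y∈) x≢y) ⟩
      q ^ (m ∸ 2)
        ≡⟨ cong (q ^_) (∸-+-cancel-pred m k 1≤k (independent-≤ (vertex-independent {x} x∈))) ⟨
      q ^ (m ∸ (1 + k) + (k ∸ 1))
        ∎

  vertex-exists : ∃ λ x → x ∈ vertex
  vertex-exists = countIn-witness vectors vertex
    (>-nonZero⁻¹ _ {{ℕ.m*n≢0⇒m≢0 (count vertex) {{subst NonZero (sym count-vertices) positive}}}})
    where
    positive : NonZero (q ^ (m ∸ k) * (q ^ k ∸ 1))
    positive = ℕ.m*n≢0 _ _ {{ℕ.m^n≢0 q (m ∸ k)}} {{>-nonZero (ℕ.m<n⇒0<n∸m (ℕ.^-monoʳ-< q 1<q 1≤k))}}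

  SameClass : V → V → Bool
  SameClass x = ⟨ x ∷ bs ⟩

  same-class-refl : ∀ {x} → x ∈ vertex → SameClass x x ≡ true
  same-class-refl {x} _ = ⟨⟩-head x bs

  same-class-sym : ∀ {x y} → x ∈ vertex → y ∈ vertex → SameClass x y ≡ true → SameClass y x ≡ true
  same-class-sym {y = y} _ y∈ y∈⟨x∷bs⟩ = ⟨⟩-exchange y∈⟨x∷bs⟩ (vertex∉⟨bs⟩ {y} y∈)

  same-class-trans : ∀ {x y z} → x ∈ vertex → y ∈ vertex → z ∈ vertex →
    SameClass x y ≡ true → SameClass y z ≡ true → SameClass x z ≡ true
  same-class-trans {z = z} _ _ _ y∈⟨x∷bs⟩ = ⟨∷⟩-mono y∈⟨x∷bs⟩ z

  open Classification vectors (allVecs-complete m) vertex SameClass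
         same-class-refl same-class-sym same-class-trans (proj₂ vertex-exists)
    public using (size; rep; rep-P; class; class-spec)

  class-points : ∀ {r} → r ∈ vertex →
    (λ y → vertex y ∧ ⟨ r ∷ bs ⟩ y) ≗ λ y → isPoint y ∧ (⟨ r ∷ bs ⟩ y ∧ not (⟨ bs ⟩ y))
  class-points {r} r∈ y = ⇔→≡ (mk⇔
    (λ y∈ → let y∈vertex = ∧-conicalˡ _ _ y∈ in
      ∧-intro (vertex-point {y} y∈vertex) (∧-intro (∧-conicalʳ _ _ y∈) (not-intro (vertex∉⟨bs⟩ {y} y∈vertex))))
    (λ y∈ → let y∈⟨r∷bs⟩ , y∉⟨bs⟩ = ∧-not-elim (∧-conicalʳ (isPoint y) _ y∈) in
      ∧-intro (∧-intro (∧-conicalˡ _ _ y∈) (not-intro (y∉ζπ y∈⟨r∷bs⟩ y∉⟨bs⟩))) y∈⟨r∷bs⟩))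
    where
    y∉ζπ : y ∈ ⟨ r ∷ bs ⟩ → ¬ y ∈ ⟨ bs ⟩ → ¬ y ∈ ζ π
    y∉ζπ y∈⟨r∷bs⟩ y∉⟨bs⟩ y∈ζπ = vertex∉ζπ {r} r∈
      (⟨⟩-least (subspace↦subspace π π-subspace) (y∈ζπ ∷ All.map (λ {w} → ⟨bs⟩⊆ζπ w) (⟨⟩-generators bs))
                r (⟨⟩-exchange y∈⟨r∷bs⟩ y∉⟨bs⟩))

  count-class : ∀ {r} → r ∈ vertex → count (λ y → vertex y ∧ ⟨ r ∷ bs ⟩ y) ≡ q ^ k
  count-class {r} r∈ = *-∸1-cancel q 1<q (begin
    X * (q ∸ 1)          ≡⟨ pow-split q k 1 X (begin
      X * (q ∸ 1) + q ^ k
        ≡⟨ cong₂ (λ n c → n * (q ∸ 1) + c) (countIn-cong vectors (class-points {r} r∈))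
                                           (sym (count-⟨⟩ bs-independent)) ⟩
      count (λ y → isPoint y ∧ (⟨ r ∷ bs ⟩ y ∧ not (⟨ bs ⟩ y))) * (q ∸ 1) + count ⟨ bs ⟩
        ≡⟨ count-points-between (⟨⟩-subspace (r ∷ bs)) (⟨⟩-subspace bs) (⟨⟩-tail r bs) ⟩
      count ⟨ r ∷ bs ⟩
        ≡⟨ count-⟨⟩ (vertex-independent {r} r∈) ⟩
      q ^ suc k
        ≡⟨ cong (q ^_) (ℕ.+-comm 1 k) ⟩
      q ^ (k + 1)
        ∎) ⟩
    q ^ k * (q ^ 1 ∸ 1)  ≡⟨ cong (λ n → q ^ k * (n ∸ 1)) (ℕ.*-identityʳ q) ⟩
    q ^ k * (q ∸ 1)      ∎)
    where
    open ≡-Reasoning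
    X = count (λ y → vertex y ∧ ⟨ r ∷ bs ⟩ y)

  class-size : ∀ i → count (λ y → vertex y ∧ does (class y Fin.≟ i)) ≡ q ^ k
  class-size i = trans (countIn-cong vectors in-class) (count-class (rep-P i))
    where
    in-class : ∀ y → (vertex y ∧ does (class y Fin.≟ i)) ≡ (vertex y ∧ ⟨ rep i ∷ bs ⟩ y)
    in-class y with vertex y in y∈
    ... | false = refl
    ... | true  = ⇔→≡ (mk⇔ (λ d → Equivalence.to (class-spec y∈ i) (does-true⇒ (class y Fin.≟ i) d))
                           (λ r → dec-true (class y Fin.≟ i) (Equivalence.from (class-spec y∈ i) r)))

  count-vertices-by-class : count vertex ≡ size * q ^ k
  count-vertices-by-class = begin
    count vertex                                                   ≡⟨ countIn-fibres vectors class vertex ⟩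
    ∑[ i < size ] count (λ y → vertex y ∧ does (class y Fin.≟ i))  ≡⟨ sum-cong-≗ class-size ⟩
    ∑[ i < size ] (q ^ k)                                          ≡⟨ ∑-const size (q ^ k) ⟩
    size * q ^ k                                                   ∎
    where open ≡-Reasoning

  same-class : ∀ {x y} → x ∈ vertex → y ∈ vertex → class x ≡ class y → y ∈ ⟨ x ∷ bs ⟩
  same-class {x} {y} x∈ y∈ eq = same-class-trans x∈ (rep-P (class y)) y∈
    (same-class-sym (rep-P (class y)) x∈ (Equivalence.to (class-spec x∈ (class y)) eq))
    (Equivalence.to (class-spec y∈ (class y)) refl)

  different-class : ∀ {x y} → x ∈ vertex → y ∈ vertex → ¬ class x ≡ class y → ¬ x ∈ ⟨ y ∷ bs ⟩
  different-class {x} {y} x∈ y∈ x≢y x∈⟨y∷bs⟩ = x≢y (Equivalence.from (class-spec x∈ (class y))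
    (same-class-trans (rep-P (class y)) y∈ x∈ (Equivalence.to (class-spec y∈ (class y)) refl) x∈⟨y∷bs⟩))

  k≤m∸k : k ≤ m ∸ k
  k≤m∸k = ^-cancelʳ-≤ q 1<q (begin
    q ^ k             ≡⟨ count-⟨⟩ bs-independent ⟨
    count ⟨ bs ⟩      ≡⟨ countIn-cong vectors π≗⟨bs⟩ ⟨
    count π           ≤⟨ countIn-mono vectors π-isotropic ⟩
    count (ζ π)       ≡⟨ countIn-cong vectors ζπ≗ζ⟨bs⟩ ⟩
    count (ζ ⟨ bs ⟩)  ≡⟨ count-ζ⟨⟩ bs-independent ⟩
    q ^ (m ∸ k)       ∎)
    where open ℕ.≤-Reasoning

  size-formula : size * (q ∸ 1) ≡ q ^ (m ∸ k) ∸ q ^ (m ∸ k ∸ k)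
  size-formula = subst (λ e → size * (q ∸ 1) ≡ q ^ e ∸ q ^ (m ∸ k ∸ k)) (ℕ.m∸n+n≡m k≤m∸k)
    (*-pow-cancel q (m ∸ k ∸ k) k size (begin
      size * q ^ k * (q ∸ 1)             ≡⟨ cong (_* (q ∸ 1)) count-vertices-by-class ⟨
      count vertex * (q ∸ 1)             ≡⟨ count-vertices ⟩
      q ^ (m ∸ k) * (q ^ k ∸ 1)          ≡⟨ cong (λ e → q ^ e * (q ^ k ∸ 1)) (ℕ.m∸n+n≡m k≤m∸k) ⟨
      q ^ (m ∸ k ∸ k + k) * (q ^ k ∸ 1)  ∎))
    where open ≡-Reasoning

  valency λ-same λ-apart : ℕ
  valency = q ^ (m ∸ k ∸ 1) * geometric q k
  λ-same  = q ^ (m ∸ k ∸ 1) * geometric q (k ∸ 1)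
  λ-apart = q ^ (m ∸ k ∸ 2) * geometric q k

  isLDDG : IsLDDG vertex (adj ζ) (count vertex) valency λ-same λ-apart size (q ^ k)
  isLDDG = refl
         , (λ x x∈ → *-∸1-cancel q 1<q (trans (degree {x} x∈) (sym (pow-geometric q (m ∸ k ∸ 1) k))))
         , class
         , class-size
         , (λ x y x∈ y∈ x≢y same → *-∸1-cancel q 1<q
              (trans (common-together x∈ y∈ x≢y (same-class x∈ y∈ same)) (sym (pow-geometric q (m ∸ k ∸ 1) (k ∸ 1)))))
         , (λ x y x∈ y∈ apart → *-∸1-cancel q 1<q
              (trans (common-apart x∈ y∈ (different-class x∈ y∈ apart)) (sym (pow-geometric q (m ∸ k ∸ 2) k))))

open import Data.Nat using (_*_; _∸_; _^_)
open import Data.Product using (∃; _×_; _,_)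
open import Relation.Binary.PropositionalEquality using (_≡_)
open Arithmetic using (pow-geometric)

corollary4p5 : (q : ℕ) (F : FiniteField q) (m : ℕ) → 3 ≤ m →
    let open Geometry F m in
    (ζ : Pred → Pred) → IsPolarity ζ →
    (k : ℕ) → 1 ≤ k →
    (π : Pred) → IsSubspace π → HasDim π k → π ⊆ ζ π →
    ∃ λ v → ∃ λ K → ∃ λ λ₁ → ∃ λ λ₂ → ∃ λ M →
        v * (q ∸ 1) ≡ q ^ (m ∸ k) * (q ^ k ∸ 1)
      × K * (q ∸ 1) ≡ q ^ (m ∸ k ∸ 1) * (q ^ k ∸ 1)
      × λ₁ * (q ∸ 1) ≡ q ^ (m ∸ k ∸ 1) * (q ^ (k ∸ 1) ∸ 1)
      × λ₂ * (q ∸ 1) ≡ q ^ (m ∸ k ∸ 2) * (q ^ k ∸ 1)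
      × M * (q ∸ 1) ≡ q ^ (m ∸ k) ∸ q ^ (m ∸ k ∸ k)
      × IsLDDG (isVertex ζ π) (adj ζ) v K λ₁ λ₂ M (q ^ k)
corollary4p5 q F m _ ζ isPolarity k 1≤k π π-subspace π-dim π-isotropic =
    count vertex , valency , λ-same , λ-apart , size
  , count-vertices
  , pow-geometric q (m ∸ k ∸ 1) k
  , pow-geometric q (m ∸ k ∸ 1) (k ∸ 1)
  , pow-geometric q (m ∸ k ∸ 2) k
  , size-formula
  , isLDDG
  where
  open Geometry F m using (count)
  open PolarGraph F m ζ isPolarity k 1≤k π π-subspace π-dim π-isotropic
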